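{- Let $L$ be a nonnegative integer and let $q,z$ be indeterminates. Then \[ \sum_{n=0}^{2L}\frac{(-1)^n z^{ -L}q^{n(2L-n+1)}+z^{L-n+1}}{q^n+z}\,q^{T_{L-n}} =\sum_{i,j,k\ge 0}(-1)^k z^{i-j}q^{T_i+T_j+T_k-j}\begin{bmatrix}L-i\\ j\end{bmatrix}\begin{bmatrix}L-j\\ k\end{bmatrix}\begin{bmatrix}L-k\\ i\end{bmatrix}. \]
   Context: For any integer $n$ (including negative $n$), $T_n=n(n+1)/2$. For a nonnegative integer $n$, $(a;q)_n=\prod_{k=0}^{n-1}(1-aq^k)$. For integers $n,k$, the $q$-binomial coefficient is $\begin{bmatrix}n\\ k\end{bmatrix}=\frac{(q;q)_n}{(q;q)_k(q;q)_{n-k}}$ if $0\le k\le n$ and $0$ otherwise. The identity is an identity of rational functions in $q,z$. -}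

module Defs where

open import Data.Nat as ℕ using (ℕ; zero; suc)
open import Data.Integer as ℤ using (ℤ; +_; -[1+_])
open import Data.Rational using (ℚ; 0ℚ; 1ℚ; _+_; _*_; -_; 1/_; ≢-nonZero)
open import Data.Rational.Properties using (_≟_)
open import Relation.Nullary using (yes; no)

-- Total inverse on ℚ (inv 0 = 0); only ever applied to nonzero values
-- under the hypotheses of the theorem.
inv : ℚ → ℚ
inv p with p ≟ 0ℚ
... | yes _ = 0ℚ
... | no p≢0 = 1/_ p {{≢-nonZero p≢0}}

powℕ : ℚ → ℕ → ℚ
powℕ x zero = 1ℚ
powℕ x (suc n) = x * powℕ x n

powℤ : ℚ → ℤ → ℚ
powℤ x (+ n) = powℕ x n
powℤ x -[1+ n ] = inv (powℕ x (suc n))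

-- T_n = n(n+1)/2 for any integer n (exact division)
T : ℤ → ℤ
T n = (n ℤ.* (n ℤ.+ + 1)) ℤ./ (+ 2)

qPoch : ℚ → ℕ → ℚ
qPoch q zero = 1ℚ
qPoch q (suc m) = qPoch q m * (1ℚ + - (q * powℕ q m))

qBin : ℚ → ℤ → ℤ → ℚ
qBin q (+ n) (+ k) with k ℕ.≤? n
... | yes _ = qPoch q n * inv (qPoch q k * qPoch q (n ℕ.∸ k))
... | no _ = 0ℚ
qBin q (+ n) -[1+ k ] = 0ℚ
qBin q -[1+ n ] k = 0ℚ

sumTo : ℕ → (ℕ → ℚ) → ℚ
sumTo zero f = f zero
sumTo (suc N) f = sumTo N f + f (suc N)

sgn : ℕ → ℚ
sgn n = powℕ (- 1ℚ) n

lhsTerm : ℕ → ℚ → ℚ → ℕ → ℚ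
lhsTerm L q z n =
  (sgn n * powℤ z (ℤ.- (+ L)) * powℤ q (+ n ℤ.* (+ (2 ℕ.* L) ℤ.- + n ℤ.+ + 1))
    + powℤ z (+ L ℤ.- + n ℤ.+ + 1))
  * inv (powℕ q n + z)
  * powℤ q (T (+ L ℤ.- + n))

LHS : ℕ → ℚ → ℚ → ℚ
LHS L q z = sumTo (2 ℕ.* L) (lhsTerm L q z)

rhsTerm : ℕ → ℚ → ℚ → ℕ → ℕ → ℕ → ℚ
rhsTerm L q z i j k =
  sgn k * powℤ z (+ i ℤ.- + j)
  * powℤ q (T (+ i) ℤ.+ T (+ j) ℤ.+ T (+ k) ℤ.- + j)
  * qBin q (+ L ℤ.- + i) (+ j)
  * qBin q (+ L ℤ.- + j) (+ k)
  * qBin q (+ L ℤ.- + k) (+ i)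

-- Σ_{i,j,k ≥ 0}; all terms with i > L, j > L or k > L vanish
-- (some q-binomial has negative top entry), so the sum is over 0..L.
RHS : ℕ → ℚ → ℚ → ℚ
RHS L q z = sumTo L (λ i → sumTo L (λ j → sumTo L (λ k → rhsTerm L q z i j k)))

-- Both sides equal z^(-L) Σ_{t ≤ 2L} z^t c(2L-t), where c N = Σ_{n ≤ N} q^(T(L-n)) (-q^n)^(N-n).
-- On the left, the numerator of the n-th term is z^(-L) (z^(K+1) - (-q^n)^(K+1)) with K = 2L - n,
-- so dividing by z + q^n leaves a geometric sum in z.
-- On the right, the sum over k does not change when the top entry L of [L-k,i] is lowered to
-- L - j (the increments are q-differences of order L - j of polynomials of lower degree), and
-- then Rothe's q-binomial theorem turns q^(T i) times it into Σ_r (-1)^r q^(T(i+r)) [L-i-j,r].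
-- Grouping the terms by t = L + i - j and p = j + r, the sum over j is another q-difference,
-- Σ_j (-1)^j q^(j(j-1)/2) [p,j] [N-j,p] = q^(p(N-p)), and reversing p ↦ N - p gives c N.

module Submission where

open import Defs
open import Data.Nat using (ℕ; zero; suc; _≤_; _<_; _∸_; z≤n; s≤s)
import Data.Nat as ℕ
import Data.Nat.Properties as ℕₚ
open import Data.Nat.DivMod using (m*n/n≡m)
import Data.Nat.Tactic.RingSolver as ℕ-Ring
open import Data.Integer as ℤ using (ℤ; +_; -[1+_])
import Data.Integer.Properties as ℤₚ
import Data.Integer.Tactic.RingSolver as ℤ-Ring
open import Data.Rational using (ℚ; 0ℚ; 1ℚ; _+_; _*_; -_; ≢-nonZero)
import Data.Rational.Properties as ℚₚ
open import Data.Sum using (_⊎_; inj₁; inj₂)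
open import Data.Empty using (⊥-elim)
open import Level using (0ℓ)
open import Relation.Nullary using (Dec; yes; no)
open import Relation.Nullary.Decidable using (dec⇒maybe)
open import Relation.Binary.PropositionalEquality
open import Tactic.RingSolver using (solve-∀)
open import Tactic.RingSolver.Core.AlmostCommutativeRing
  using (AlmostCommutativeRing; fromCommutativeRing)

open ≡-Reasoning

ℚ-ring : AlmostCommutativeRing 0ℓ 0ℓ
ℚ-ring = fromCommutativeRing ℚₚ.+-*-commutativeRing (λ x → dec⇒maybe (0ℚ ℚₚ.≟ x))

∸-comm : ∀ m n o → (m ∸ n) ∸ o ≡ (m ∸ o) ∸ n
∸-comm m n o = trans (ℕₚ.∸-+-assoc m n o) (trans (cong (m ∸_) (ℕₚ.+-comm n o)) (sym (ℕₚ.∸-+-assoc m o n)))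

m<n+n⇒m∸n<n : ∀ {m n} → m < n ℕ.+ n → m ∸ n < n
m<n+n⇒m∸n<n {m} {n} m<n+n with n ℕₚ.≤? m
... | yes n≤m = ℕₚ.+-cancelʳ-< n (m ∸ n) n (subst (_< n ℕ.+ n) (sym (ℕₚ.m∸n+n≡m n≤m)) m<n+n)
... | no  n≰m = subst (_< n) (sym (ℕₚ.m≤n⇒m∸n≡0 (ℕₚ.<⇒≤ (ℕₚ.≰⇒> n≰m))))
                      (ℕₚ.≤-<-trans z≤n (ℕₚ.≰⇒> n≰m))

+2L≡+L+L : ∀ L → + (2 ℕ.* L) ≡ + L ℤ.+ + L
+2L≡+L+L L = cong (λ m → + (L ℕ.+ m)) (ℕₚ.+-identityʳ L)

+[m∸n]≡+m-+n : ∀ {m n} → n ≤ m → + (m ∸ n) ≡ + m ℤ.- + n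
+[m∸n]≡+m-+n {m} {n} n≤m = sym (trans (ℤₚ.m-n≡m⊖n m n) (ℤₚ.⊖-≥ n≤m))

-- Finite sums

∑ : ℕ → (ℕ → ℚ) → ℚ
∑ zero    f = 0ℚ
∑ (suc n) f = ∑ n f + f n

syntax ∑ n (λ i → x) = ∑[ i < n ] x

sumTo≡∑ : ∀ N f → sumTo N f ≡ ∑ (suc N) f
sumTo≡∑ zero    f = sym (ℚₚ.+-identityˡ (f 0))
sumTo≡∑ (suc N) f = cong (_+ f (suc N)) (sumTo≡∑ N f)

∑-cong : ∀ n {f g : ℕ → ℚ} → (∀ i → i < n → f i ≡ g i) → ∑ n f ≡ ∑ n g
∑-cong zero    f≡g = refl
∑-cong (suc n) f≡g =
  cong₂ _+_ (∑-cong n (λ i i<n → f≡g i (ℕₚ.m<n⇒m<1+n i<n))) (f≡g n ℕₚ.≤-refl)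

∑-zero : ∀ n {f : ℕ → ℚ} → (∀ i → i < n → f i ≡ 0ℚ) → ∑ n f ≡ 0ℚ
∑-zero zero    f≡0 = refl
∑-zero (suc n) f≡0 = cong₂ _+_ (∑-zero n (λ i i<n → f≡0 i (ℕₚ.m<n⇒m<1+n i<n))) (f≡0 n ℕₚ.≤-refl)

∑-distrib-+ : ∀ n (f g : ℕ → ℚ) → ∑[ i < n ] (f i + g i) ≡ ∑ n f + ∑ n g
∑-distrib-+ zero    f g = refl
∑-distrib-+ (suc n) f g = begin
  ∑[ i < n ] (f i + g i) + (f n + g n) ≡⟨ cong (_+ (f n + g n)) (∑-distrib-+ n f g) ⟩
  ∑ n f + ∑ n g + (f n + g n)          ≡⟨ interchange (∑ n f) (∑ n g) (f n) (g n) ⟩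
  ∑ n f + f n + (∑ n g + g n)          ∎
  where
  interchange : ∀ a b c d → a + b + (c + d) ≡ a + c + (b + d)
  interchange = solve-∀ ℚ-ring

*-distribˡ-∑ : ∀ n c (f : ℕ → ℚ) → c * ∑ n f ≡ ∑[ i < n ] (c * f i)
*-distribˡ-∑ zero    c f = ℚₚ.*-zeroʳ c
*-distribˡ-∑ (suc n) c f =
  trans (ℚₚ.*-distribˡ-+ c (∑ n f) (f n)) (cong (_+ c * f n) (*-distribˡ-∑ n c f))

∑-+ : ∀ m n (f : ℕ → ℚ) → ∑ (m ℕ.+ n) f ≡ ∑ m f + ∑[ i < n ] f (m ℕ.+ i)
∑-+ m zero    f = trans (cong (λ k → ∑ k f) (ℕₚ.+-identityʳ m)) (sym (ℚₚ.+-identityʳ (∑ m f)))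
∑-+ m (suc n) f = begin
  ∑ (m ℕ.+ suc n) f                                 ≡⟨ cong (λ k → ∑ k f) (ℕₚ.+-suc m n) ⟩
  ∑ (m ℕ.+ n) f + f (m ℕ.+ n)                       ≡⟨ cong (_+ f (m ℕ.+ n)) (∑-+ m n f) ⟩
  ∑ m f + ∑[ i < n ] f (m ℕ.+ i) + f (m ℕ.+ n)      ≡⟨ ℚₚ.+-assoc (∑ m f) _ _ ⟩
  ∑ m f + (∑[ i < n ] f (m ℕ.+ i) + f (m ℕ.+ n))    ∎

∑-sucˡ : ∀ n (f : ℕ → ℚ) → ∑ (suc n) f ≡ f 0 + ∑[ i < n ] f (suc i)
∑-sucˡ n f = trans (∑-+ 1 n f) (cong (_+ ∑[ i < n ] f (suc i)) (ℚₚ.+-identityˡ (f 0)))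

∑-trim : ∀ {m n} (f : ℕ → ℚ) → m ≤ n → (∀ i → m ≤ i → i < n → f i ≡ 0ℚ) → ∑ n f ≡ ∑ m f
∑-trim {n = zero}  f z≤n    f≡0 = refl
∑-trim {m} {suc n} f m≤1+n f≡0 with ℕₚ.m≤n⇒m<n∨m≡n m≤1+n
... | inj₂ refl      = refl
... | inj₁ (s≤s m≤n) = begin
  ∑ n f + f n ≡⟨ cong₂ _+_ (∑-trim f m≤n (λ i m≤i i<n → f≡0 i m≤i (ℕₚ.m<n⇒m<1+n i<n)))
                           (f≡0 n m≤n ℕₚ.≤-refl) ⟩
  ∑ m f + 0ℚ  ≡⟨ ℚₚ.+-identityʳ (∑ m f) ⟩
  ∑ m f       ∎

∑-window : ∀ a m b (f : ℕ → ℚ) →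
           (∀ i → i < a → f i ≡ 0ℚ) → (∀ u → u < b → f (a ℕ.+ m ℕ.+ u) ≡ 0ℚ) →
           ∑ (a ℕ.+ m ℕ.+ b) f ≡ ∑[ i < m ] f (a ℕ.+ i)
∑-window a m b f below above = begin
  ∑ (a ℕ.+ m ℕ.+ b) f                           ≡⟨ ∑-+ (a ℕ.+ m) b f ⟩
  ∑ (a ℕ.+ m) f + ∑[ u < b ] f (a ℕ.+ m ℕ.+ u) ≡⟨ cong (_+_ (∑ (a ℕ.+ m) f)) (∑-zero b above) ⟩
  ∑ (a ℕ.+ m) f + 0ℚ                            ≡⟨ ℚₚ.+-identityʳ _ ⟩
  ∑ (a ℕ.+ m) f                                 ≡⟨ ∑-+ a m f ⟩
  ∑ a f + ∑[ i < m ] f (a ℕ.+ i)                ≡⟨ cong (_+ ∑[ i < m ] f (a ℕ.+ i)) (∑-zero a below) ⟩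
  0ℚ + ∑[ i < m ] f (a ℕ.+ i)                   ≡⟨ ℚₚ.+-identityˡ _ ⟩
  ∑[ i < m ] f (a ℕ.+ i)                        ∎

∑-comm : ∀ m n (f : ℕ → ℕ → ℚ) → ∑[ i < m ] ∑[ j < n ] f i j ≡ ∑[ j < n ] ∑[ i < m ] f i j
∑-comm zero    n f = sym (∑-zero n (λ _ _ → refl))
∑-comm (suc m) n f = begin
  ∑[ i < m ] ∑[ j < n ] f i j + ∑[ j < n ] f m j ≡⟨ cong (_+ ∑[ j < n ] f m j) (∑-comm m n f) ⟩
  ∑[ j < n ] ∑[ i < m ] f i j + ∑[ j < n ] f m j ≡⟨ ∑-distrib-+ n _ (f m) ⟨
  ∑[ j < n ] (∑[ i < m ] f i j + f m j)          ∎

∑-reverse : ∀ n (f : ℕ → ℚ) → ∑ n f ≡ ∑[ i < n ] f (n ∸ suc i)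
∑-reverse zero    f = refl
∑-reverse (suc n) f = begin
  ∑ n f + f n                        ≡⟨ cong (_+ f n) (∑-reverse n f) ⟩
  ∑[ i < n ] f (n ∸ suc i) + f n     ≡⟨ ℚₚ.+-comm _ (f n) ⟩
  f n + ∑[ i < n ] f (n ∸ suc i)     ≡⟨ ∑-sucˡ n (λ i → f (n ∸ i)) ⟨
  ∑[ i < suc n ] f (n ∸ i)           ∎

∑-antidiagonal : ∀ n (g : ℕ → ℕ → ℚ) →
                 ∑[ i < n ] ∑[ j < n ∸ i ] g i j ≡ ∑[ p < n ] ∑[ i < suc p ] g i (p ∸ i)
∑-antidiagonal zero    g = refl
∑-antidiagonal (suc n) g = begin
  ∑[ i < suc n ] ∑[ j < suc n ∸ i ] g i j
    ≡⟨ ∑-cong (suc n) (λ i i≤n → cong (λ k → ∑ k (g i)) (ℕₚ.+-∸-assoc 1 (ℕₚ.≤-pred i≤n))) ⟩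
  ∑[ i < suc n ] (∑[ j < n ∸ i ] g i j + g i (n ∸ i))
    ≡⟨ ∑-distrib-+ (suc n) _ _ ⟩
  ∑[ i < n ] ∑[ j < n ∸ i ] g i j + ∑[ j < n ∸ n ] g n j + ∑[ i < suc n ] g i (n ∸ i)
    ≡⟨ cong (λ k → ∑[ i < n ] ∑[ j < n ∸ i ] g i j + ∑ k (g n) + ∑[ i < suc n ] g i (n ∸ i))
            (ℕₚ.n∸n≡0 n) ⟩
  ∑[ i < n ] ∑[ j < n ∸ i ] g i j + 0ℚ + ∑[ i < suc n ] g i (n ∸ i)
    ≡⟨ cong (λ s → s + ∑[ i < suc n ] g i (n ∸ i))
            (trans (ℚₚ.+-identityʳ _) (∑-antidiagonal n g)) ⟩
  ∑[ p < n ] ∑[ i < suc p ] g i (p ∸ i) + ∑[ i < suc n ] g i (n ∸ i)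
    ∎

∑-triangle-comm : ∀ n (g : ℕ → ℕ → ℚ) →
                  ∑[ i < n ] ∑[ j < n ∸ i ] g i j ≡ ∑[ j < n ] ∑[ i < n ∸ j ] g i j
∑-triangle-comm n g = begin
  ∑[ i < n ] ∑[ j < n ∸ i ] g i j         ≡⟨ ∑-antidiagonal n g ⟩
  ∑[ p < n ] ∑[ i < suc p ] g i (p ∸ i)   ≡⟨ ∑-cong n (λ p _ → antidiagonal-flip p) ⟩
  ∑[ p < n ] ∑[ j < suc p ] g (p ∸ j) j   ≡⟨ ∑-antidiagonal n (λ j i → g i j) ⟨
  ∑[ j < n ] ∑[ i < n ∸ j ] g i j         ∎
  where
  antidiagonal-flip : ∀ p → ∑[ i < suc p ] g i (p ∸ i) ≡ ∑[ j < suc p ] g (p ∸ j) j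
  antidiagonal-flip p = trans (∑-reverse (suc p) _)
    (∑-cong (suc p) (λ j j≤p → cong (g (p ∸ j)) (ℕₚ.m∸[m∸n]≡n (ℕₚ.≤-pred j≤p))))

powℕ-+ : ∀ x m n → powℕ x (m ℕ.+ n) ≡ powℕ x m * powℕ x n
powℕ-+ x zero    n = sym (ℚₚ.*-identityˡ (powℕ x n))
powℕ-+ x (suc m) n = trans (cong (x *_) (powℕ-+ x m n)) (sym (ℚₚ.*-assoc x _ _))

powℕ-* : ∀ x m n → powℕ x (m ℕ.* n) ≡ powℕ (powℕ x m) n
powℕ-* x m zero    = cong (powℕ x) (ℕₚ.*-zeroʳ m)
powℕ-* x m (suc n) = begin
  powℕ x (m ℕ.* suc n)              ≡⟨ cong (powℕ x) (ℕₚ.*-suc m n) ⟩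
  powℕ x (m ℕ.+ m ℕ.* n)            ≡⟨ powℕ-+ x m (m ℕ.* n) ⟩
  powℕ x m * powℕ x (m ℕ.* n)       ≡⟨ cong (powℕ x m *_) (powℕ-* x m n) ⟩
  powℕ x m * powℕ (powℕ x m) n      ∎

powℕ-neg : ∀ x n → powℕ (- x) n ≡ sgn n * powℕ x n
powℕ-neg x zero    = refl
powℕ-neg x (suc n) = trans (cong (- x *_) (powℕ-neg x n)) (regroup x (sgn n) (powℕ x n))
  where
  regroup : ∀ x s p → - x * (s * p) ≡ - 1ℚ * s * (x * p)
  regroup = solve-∀ ℚ-ring

sgn-+ : ∀ m n → sgn (m ℕ.+ n) ≡ sgn m * sgn n
sgn-+ = powℕ-+ (- 1ℚ)

sgn*sgn : ∀ n → sgn n * sgn n ≡ 1ℚ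
sgn*sgn zero    = refl
sgn*sgn (suc n) = trans (square-neg (sgn n)) (sgn*sgn n)
  where
  square-neg : ∀ s → - 1ℚ * s * (- 1ℚ * s) ≡ s * s
  square-neg = solve-∀ ℚ-ring

sgn-odd : ∀ {L m n} → m ℕ.+ n ≡ suc (2 ℕ.* L) → sgn m ≡ - sgn n
sgn-odd {L} {m} {n} m+n≡1+2L = begin
  sgn m                            ≡⟨ sym (ℚₚ.*-identityʳ (sgn m)) ⟩
  sgn m * 1ℚ                       ≡⟨ cong (sgn m *_) (sgn*sgn n) ⟨
  sgn m * (sgn n * sgn n)          ≡⟨ ℚₚ.*-assoc (sgn m) (sgn n) (sgn n) ⟨
  sgn m * sgn n * sgn n            ≡⟨ cong (_* sgn n) (trans (sym (sgn-+ m n)) (cong sgn m+n≡1+2L)) ⟩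
  - 1ℚ * sgn (L ℕ.+ (L ℕ.+ 0)) * sgn n
    ≡⟨ cong (λ k → - 1ℚ * sgn k * sgn n) (cong (L ℕ.+_) (ℕₚ.+-identityʳ L)) ⟩
  - 1ℚ * sgn (L ℕ.+ L) * sgn n    ≡⟨ cong (λ s → - 1ℚ * s * sgn n) (trans (sgn-+ L L) (sgn*sgn L)) ⟩
  - 1ℚ * 1ℚ * sgn n                ≡⟨ negate (sgn n) ⟩
  - sgn n                          ∎
  where
  negate : ∀ s → - 1ℚ * 1ℚ * s ≡ - s
  negate = solve-∀ ℚ-ring

sgn-∸ : ∀ {j p} → j ≤ p → sgn (p ∸ j) ≡ sgn j * sgn p
sgn-∸ {j} {p} j≤p = begin
  sgn (p ∸ j)                   ≡⟨ ℚₚ.*-identityˡ _ ⟨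
  1ℚ * sgn (p ∸ j)              ≡⟨ cong (_* sgn (p ∸ j)) (sgn*sgn j) ⟨
  sgn j * sgn j * sgn (p ∸ j)   ≡⟨ ℚₚ.*-assoc (sgn j) (sgn j) _ ⟩
  sgn j * (sgn j * sgn (p ∸ j)) ≡⟨ cong (_*_ (sgn j)) (trans (sym (sgn-+ j (p ∸ j))) (cong sgn (ℕₚ.m+[n∸m]≡n j≤p))) ⟩
  sgn j * sgn p                 ∎

inv-inverseˡ : ∀ {x} → x ≢ 0ℚ → inv x * x ≡ 1ℚ
inv-inverseˡ {x} x≢0 with x ℚₚ.≟ 0ℚ
... | yes x≡0 = ⊥-elim (x≢0 x≡0)
... | no  x≢0 = ℚₚ.*-inverseˡ x {{≢-nonZero x≢0}}

inv-inverseʳ : ∀ {x} → x ≢ 0ℚ → x * inv x ≡ 1ℚ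
inv-inverseʳ {x} x≢0 = trans (ℚₚ.*-comm x (inv x)) (inv-inverseˡ x≢0)

*-cancelˡ : ∀ {c a b} → c ≢ 0ℚ → c * a ≡ c * b → a ≡ b
*-cancelˡ {c} {a} {b} c≢0 ca≡cb = begin
  a               ≡⟨ cancel a ⟨
  inv c * (c * a) ≡⟨ cong (inv c *_) ca≡cb ⟩
  inv c * (c * b) ≡⟨ cancel b ⟩
  b               ∎
  where
  cancel : ∀ y → inv c * (c * y) ≡ y
  cancel y = begin
    inv c * (c * y) ≡⟨ ℚₚ.*-assoc (inv c) c y ⟨
    inv c * c * y   ≡⟨ cong (_* y) (inv-inverseˡ c≢0) ⟩
    1ℚ * y          ≡⟨ ℚₚ.*-identityˡ y ⟩
    y               ∎

*-≢0 : ∀ {x y} → x ≢ 0ℚ → y ≢ 0ℚ → x * y ≢ 0ℚ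
*-≢0 {x} {y} x≢0 y≢0 xy≡0 = y≢0 (*-cancelˡ x≢0 (trans xy≡0 (sym (ℚₚ.*-zeroʳ x))))

powℕ-≢0 : ∀ {x} n → x ≢ 0ℚ → powℕ x n ≢ 0ℚ
powℕ-≢0 zero    x≢0 ()
powℕ-≢0 (suc n) x≢0 = *-≢0 x≢0 (powℕ-≢0 n x≢0)

1-x≢0 : ∀ {x} → x ≢ 1ℚ → 1ℚ + - x ≢ 0ℚ
1-x≢0 {x} x≢1 1-x≡0 = x≢1 (begin
  x               ≡⟨ flip x ⟩
  1ℚ + - (1ℚ + - x) ≡⟨ cong (λ y → 1ℚ + - y) 1-x≡0 ⟩
  1ℚ              ∎)
  where
  flip : ∀ x → x ≡ 1ℚ + - (1ℚ + - x)
  flip = solve-∀ ℚ-ring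

qPoch≢0 : ∀ {q L} → (∀ k → 1 ≤ k → k ≤ L → powℕ q k ≢ 1ℚ) → ∀ m → m ≤ L → qPoch q m ≢ 0ℚ
qPoch≢0 qᵏ≢1 zero    _    ()
qPoch≢0 qᵏ≢1 (suc m) m<L = *-≢0 (qPoch≢0 qᵏ≢1 m (ℕₚ.<⇒≤ m<L)) (1-x≢0 (qᵏ≢1 (suc m) (s≤s z≤n) m<L))

powℤ-neg : ∀ x n → powℤ x (ℤ.- + n) ≡ inv (powℕ x n)
powℤ-neg x zero    = refl
powℤ-neg x (suc n) = refl

powℤ-sub : ∀ {x} a b → x ≢ 0ℚ → powℤ x (+ a ℤ.- + b) ≡ inv (powℕ x b) * powℕ x a
powℤ-sub {x} a b x≢0 = *-cancelˡ xᵇ≢0 (begin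
  powℕ x b * powℤ x (+ a ℤ.- + b)        ≡⟨ xᵇ*xᵃ⁻ᵇ≡xᵃ (b ℕₚ.≤? a) ⟩
  powℕ x a                               ≡⟨ ℚₚ.*-identityˡ (powℕ x a) ⟨
  1ℚ * powℕ x a                          ≡⟨ cong (_* powℕ x a) (inv-inverseʳ xᵇ≢0) ⟨
  powℕ x b * inv (powℕ x b) * powℕ x a   ≡⟨ ℚₚ.*-assoc (powℕ x b) _ _ ⟩
  powℕ x b * (inv (powℕ x b) * powℕ x a) ∎)
  where
  xᵇ≢0 = powℕ-≢0 b x≢0
  xᵇ*xᵃ⁻ᵇ≡xᵃ : Dec (b ≤ a) → powℕ x b * powℤ x (+ a ℤ.- + b) ≡ powℕ x a
  xᵇ*xᵃ⁻ᵇ≡xᵃ (yes b≤a) = begin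
    powℕ x b * powℤ x (+ a ℤ.- + b) ≡⟨ cong (λ e → powℕ x b * powℤ x e) (+[m∸n]≡+m-+n b≤a) ⟨
    powℕ x b * powℕ x (a ∸ b)       ≡⟨ powℕ-+ x b (a ∸ b) ⟨
    powℕ x (b ℕ.+ (a ∸ b))          ≡⟨ cong (powℕ x) (ℕₚ.m+[n∸m]≡n b≤a) ⟩
    powℕ x a                        ∎
  xᵇ*xᵃ⁻ᵇ≡xᵃ (no b≰a) = begin
    powℕ x b * powℤ x (+ a ℤ.- + b)
      ≡⟨ cong (λ e → powℕ x b * powℤ x e) (trans (ℤₚ.m-n≡m⊖n a b) (ℤₚ.⊖-≰ b≰a)) ⟩
    powℕ x b * powℤ x (ℤ.- + (b ∸ a))
      ≡⟨ cong (powℕ x b *_) (powℤ-neg x (b ∸ a)) ⟩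
    powℕ x b * inv (powℕ x (b ∸ a))
      ≡⟨ cong (λ k → powℕ x k * inv (powℕ x (b ∸ a))) b≡a+[b∸a] ⟩
    powℕ x (a ℕ.+ (b ∸ a)) * inv (powℕ x (b ∸ a))
      ≡⟨ cong (_* inv (powℕ x (b ∸ a))) (powℕ-+ x a (b ∸ a)) ⟩
    powℕ x a * powℕ x (b ∸ a) * inv (powℕ x (b ∸ a))
      ≡⟨ ℚₚ.*-assoc (powℕ x a) _ _ ⟩
    powℕ x a * (powℕ x (b ∸ a) * inv (powℕ x (b ∸ a)))
      ≡⟨ cong (powℕ x a *_) (inv-inverseʳ (powℕ-≢0 (b ∸ a) x≢0)) ⟩
    powℕ x a * 1ℚ
      ≡⟨ ℚₚ.*-identityʳ (powℕ x a) ⟩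
    powℕ x a
      ∎
    where b≡a+[b∸a] = sym (ℕₚ.m+[n∸m]≡n (ℕₚ.<⇒≤ (ℕₚ.≰⇒> b≰a)))

choose2 : ℕ → ℕ
choose2 zero    = 0
choose2 (suc n) = n ℕ.+ choose2 n

tri : ℕ → ℕ
tri n = choose2 (suc n)

-- T x as a natural number; note T (-1-n) = T n.
triℤ : ℤ → ℕ
triℤ (+ n)    = tri n
triℤ -[1+ n ] = tri n

tri+tri : ∀ n → tri n ℕ.+ tri n ≡ n ℕ.* suc n
tri+tri zero    = refl
tri+tri (suc n) = begin
  (suc n ℕ.+ tri n) ℕ.+ (suc n ℕ.+ tri n) ≡⟨ regroup n (tri n) ⟩
  2 ℕ.* suc n ℕ.+ (tri n ℕ.+ tri n)     ≡⟨ cong (2 ℕ.* suc n ℕ.+_) (tri+tri n) ⟩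
  2 ℕ.* suc n ℕ.+ n ℕ.* suc n           ≡⟨ factor n ⟩
  suc n ℕ.* suc (suc n)                 ∎
  where
  regroup : ∀ n t → (suc n ℕ.+ t) ℕ.+ (suc n ℕ.+ t) ≡ 2 ℕ.* suc n ℕ.+ (t ℕ.+ t)
  regroup = ℕ-Ring.solve-∀
  factor : ∀ n → 2 ℕ.* suc n ℕ.+ n ℕ.* suc n ≡ suc n ℕ.* suc (suc n)
  factor = ℕ-Ring.solve-∀

x*[x+1]≡triℤ+triℤ : ∀ x → x ℤ.* (x ℤ.+ + 1) ≡ + (triℤ x ℕ.+ triℤ x)
x*[x+1]≡triℤ+triℤ (+ n) = begin
  + n ℤ.* + (n ℕ.+ 1)      ≡⟨ ℤₚ.pos-* n (n ℕ.+ 1) ⟨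
  + (n ℕ.* (n ℕ.+ 1))      ≡⟨ cong (λ k → + (n ℕ.* k)) (ℕₚ.+-comm n 1) ⟩
  + (n ℕ.* suc n)          ≡⟨ cong +_ (tri+tri n) ⟨
  + (tri n ℕ.+ tri n)      ∎
x*[x+1]≡triℤ+triℤ -[1+ n ] = begin
  -[1+ n ] ℤ.* (-[1+ n ] ℤ.+ + 1) ≡⟨ reflect (+ n) ⟩
  + n ℤ.* + suc n                 ≡⟨ ℤₚ.pos-* n (suc n) ⟨
  + (n ℕ.* suc n)                 ≡⟨ cong +_ (tri+tri n) ⟨
  + (tri n ℕ.+ tri n)             ∎
  where
  reflect : ∀ a → ℤ.- (+ 1 ℤ.+ a) ℤ.* (ℤ.- (+ 1 ℤ.+ a) ℤ.+ + 1) ≡ a ℤ.* (+ 1 ℤ.+ a)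
  reflect = ℤ-Ring.solve-∀

T≡triℤ : ∀ x → T x ≡ + triℤ x
T≡triℤ x = begin
  (x ℤ.* (x ℤ.+ + 1)) ℤ./ + 2      ≡⟨ cong (ℤ._/ + 2) (x*[x+1]≡triℤ+triℤ x) ⟩
  + (triℤ x ℕ.+ triℤ x) ℤ./ + 2    ≡⟨ ℤₚ.*-identityˡ _ ⟩
  + ((triℤ x ℕ.+ triℤ x) ℕ./ 2)    ≡⟨ cong (λ k → + (k ℕ./ 2)) (double (triℤ x)) ⟩
  + ((triℤ x ℕ.* 2) ℕ./ 2)         ≡⟨ cong +_ (m*n/n≡m (triℤ x) 2) ⟩
  + triℤ x                         ∎
  where
  double : ∀ t → t ℕ.+ t ≡ t ℕ.* 2
  double = ℕ-Ring.solve-∀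

triℤ-suc : ∀ x → + triℤ (x ℤ.+ + 1) ≡ + triℤ x ℤ.+ x ℤ.+ + 1
triℤ-suc (+ n)           = cong +_ (trans (cong tri (ℕₚ.+-comm n 1)) (shift n (tri n)))
  where
  shift : ∀ n t → suc n ℕ.+ t ≡ t ℕ.+ n ℕ.+ 1
  shift = ℕ-Ring.solve-∀
triℤ-suc -[1+ zero ]     = refl
triℤ-suc -[1+ suc m ]    = shift (+ m) (+ tri m)
  where
  shift : ∀ a t → t ≡ (+ 1 ℤ.+ a ℤ.+ t) ℤ.+ ℤ.- (+ 1 ℤ.+ (+ 1 ℤ.+ a)) ℤ.+ + 1
  shift = ℤ-Ring.solve-∀

triℤ-step : ∀ x r d e → + e ≡ x ℤ.+ + suc (r ℕ.+ d) →
            triℤ (x ℤ.+ + suc r) ℕ.+ d ≡ triℤ (x ℤ.+ + r) ℕ.+ e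
triℤ-step x r d e e≡ = ℤₚ.+-injective (begin
  + triℤ (x ℤ.+ + suc r) ℤ.+ + d             ≡⟨ cong (λ y → + triℤ y ℤ.+ + d) (assoc x (+ r)) ⟩
  + triℤ (x ℤ.+ + r ℤ.+ + 1) ℤ.+ + d         ≡⟨ cong (ℤ._+ + d) (triℤ-suc (x ℤ.+ + r)) ⟩
  + triℤ (x ℤ.+ + r) ℤ.+ (x ℤ.+ + r) ℤ.+ + 1 ℤ.+ + d ≡⟨ regroup (+ triℤ (x ℤ.+ + r)) x (+ r) (+ d) ⟩
  + triℤ (x ℤ.+ + r) ℤ.+ (x ℤ.+ + suc (r ℕ.+ d)) ≡⟨ cong (ℤ._+_ (+ triℤ (x ℤ.+ + r))) e≡ ⟨
  + triℤ (x ℤ.+ + r) ℤ.+ + e                 ∎)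
  where
  assoc : ∀ x r → x ℤ.+ (+ 1 ℤ.+ r) ≡ x ℤ.+ r ℤ.+ + 1
  assoc = ℤ-Ring.solve-∀
  regroup : ∀ t x r d → t ℤ.+ (x ℤ.+ r) ℤ.+ + 1 ℤ.+ d ≡ t ℤ.+ (x ℤ.+ (+ 1 ℤ.+ (r ℤ.+ d)))
  regroup = ℤ-Ring.solve-∀

T+T+T-j≡ : ∀ i j k → T (+ i) ℤ.+ T (+ j) ℤ.+ T (+ k) ℤ.- + j ≡ + (tri i ℕ.+ choose2 j ℕ.+ tri k)
T+T+T-j≡ i j k = begin
  T (+ i) ℤ.+ T (+ j) ℤ.+ T (+ k) ℤ.- + j
    ≡⟨ cong₂ (λ x y → x ℤ.+ y ℤ.+ T (+ k) ℤ.- + j) (T≡triℤ (+ i)) (T≡triℤ (+ j)) ⟩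
  + tri i ℤ.+ + tri j ℤ.+ T (+ k) ℤ.- + j
    ≡⟨ cong (λ x → + tri i ℤ.+ + tri j ℤ.+ x ℤ.- + j) (T≡triℤ (+ k)) ⟩
  + tri i ℤ.+ (+ j ℤ.+ + choose2 j) ℤ.+ + tri k ℤ.- + j
    ≡⟨ cancel (+ tri i) (+ j) (+ choose2 j) (+ tri k) ⟩
  + (tri i ℕ.+ choose2 j ℕ.+ tri k)
    ∎
  where
  cancel : ∀ a j c b → a ℤ.+ (j ℤ.+ c) ℤ.+ b ℤ.- j ≡ a ℤ.+ c ℤ.+ b
  cancel = ℤ-Ring.solve-∀

tri+[m∸k∸c]≡choose2+[m∸c] : ∀ k c m → k ℕ.+ c ≤ m → tri k ℕ.+ (m ∸ k ∸ c) ≡ choose2 k ℕ.+ (m ∸ c)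
tri+[m∸k∸c]≡choose2+[m∸c] k c m k+c≤m = begin
  k ℕ.+ choose2 k ℕ.+ (m ∸ k ∸ c)   ≡⟨ regroup k (choose2 k) (m ∸ k ∸ c) ⟩
  choose2 k ℕ.+ (k ℕ.+ (m ∸ k ∸ c)) ≡⟨ cong (choose2 k ℕ.+_) m∸c≡k+[m∸k∸c] ⟨
  choose2 k ℕ.+ (m ∸ c)             ∎
  where
  regroup : ∀ k t r → k ℕ.+ t ℕ.+ r ≡ t ℕ.+ (k ℕ.+ r)
  regroup = ℕ-Ring.solve-∀
  m∸c≡k+[m∸k∸c] : m ∸ c ≡ k ℕ.+ (m ∸ k ∸ c)
  m∸c≡k+[m∸k∸c] = trans (cong (_∸ c) (sym (ℕₚ.m+[n∸m]≡n (ℕₚ.≤-trans (ℕₚ.m≤m+n k c) k+c≤m))))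
                        (ℕₚ.+-∸-assoc k (ℕₚ.m+n≤o⇒m≤o∸n c (subst (_≤ m) (ℕₚ.+-comm k c) k+c≤m)))

powℕ-tri-shift : ∀ x k c m → k ℕ.+ c ≤ m →
                 powℕ x (tri k) * powℕ x (m ∸ k ∸ c) ≡ powℕ x (choose2 k) * powℕ x (m ∸ c)
powℕ-tri-shift x k c m k+c≤m = begin
  powℕ x (tri k) * powℕ x (m ∸ k ∸ c)  ≡⟨ powℕ-+ x (tri k) (m ∸ k ∸ c) ⟨
  powℕ x (tri k ℕ.+ (m ∸ k ∸ c))       ≡⟨ cong (powℕ x) (tri+[m∸k∸c]≡choose2+[m∸c] k c m k+c≤m) ⟩
  powℕ x (choose2 k ℕ.+ (m ∸ c))       ≡⟨ powℕ-+ x (choose2 k) (m ∸ c) ⟩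
  powℕ x (choose2 k) * powℕ x (m ∸ c)  ∎

-- Gaussian binomial coefficients

module Gaussian (q : ℚ) where

  infix 8 _C_

  _C_ : ℕ → ℕ → ℚ
  zero  C zero  = 1ℚ
  zero  C suc k = 0ℚ
  suc n C zero  = 1ℚ
  suc n C suc k = powℕ q (n ∸ k) * n C k + n C suc k

  n<k⇒nCk≡0 : ∀ {n k} → n < k → n C k ≡ 0ℚ
  n<k⇒nCk≡0 {zero}  {suc k} _         = refl
  n<k⇒nCk≡0 {suc n} {suc k} (s≤s n<k) = begin
    powℕ q (n ∸ k) * n C k + n C suc k ≡⟨ cong₂ (λ a b → powℕ q (n ∸ k) * a + b)
                                                 (n<k⇒nCk≡0 n<k) (n<k⇒nCk≡0 (ℕₚ.m<n⇒m<1+n n<k)) ⟩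
    powℕ q (n ∸ k) * 0ℚ + 0ℚ           ≡⟨ cong (_+ 0ℚ) (ℚₚ.*-zeroʳ (powℕ q (n ∸ k))) ⟩
    0ℚ                                 ∎

  nC0≡1 : ∀ n → n C 0 ≡ 1ℚ
  nC0≡1 zero    = refl
  nC0≡1 (suc n) = refl

  nCn≡1 : ∀ n → n C n ≡ 1ℚ
  nCn≡1 zero    = refl
  nCn≡1 (suc n) = begin
    powℕ q (n ∸ n) * n C n + n C suc n ≡⟨ cong₂ (λ e c → powℕ q e * c + n C suc n) (ℕₚ.n∸n≡0 n) (nCn≡1 n) ⟩
    1ℚ * 1ℚ + n C suc n                ≡⟨ cong (λ c → 1ℚ * 1ℚ + c) (n<k⇒nCk≡0 (ℕₚ.n<1+n n)) ⟩
    1ℚ                                 ∎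

  -- n ∸ k = 1 + (n ∸ (1 + k)) unless n ≤ k, and then n C (1 + k) vanishes.
  ∸-shift : ∀ (f : ℕ → ℚ) n k → f (n ∸ k) * n C suc k ≡ f (suc (n ∸ suc k)) * n C suc k
  ∸-shift f n k with k ℕₚ.<? n
  ... | yes k<n = cong (λ e → f e * n C suc k) (ℕₚ.+-∸-assoc 1 k<n)
  ... | no  k≮n = begin
    f (n ∸ k) * n C suc k              ≡⟨ cong (f (n ∸ k) *_) nC[1+k]≡0 ⟩
    f (n ∸ k) * 0ℚ                     ≡⟨ ℚₚ.*-zeroʳ (f (n ∸ k)) ⟩
    0ℚ                                 ≡⟨ ℚₚ.*-zeroʳ (f (suc (n ∸ suc k))) ⟨
    f (suc (n ∸ suc k)) * 0ℚ           ≡⟨ cong (f (suc (n ∸ suc k)) *_) nC[1+k]≡0 ⟨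
    f (suc (n ∸ suc k)) * n C suc k    ∎
    where nC[1+k]≡0 = n<k⇒nCk≡0 (s≤s (ℕₚ.≮⇒≥ k≮n))

  pascal′ : ∀ n k → suc n C suc k ≡ n C k + powℕ q (suc k) * n C suc k
  pascal′ zero    zero    = sym (cong (_+_ 1ℚ) (ℚₚ.*-zeroʳ (powℕ q 1)))
  pascal′ zero    (suc k) = sym (trans (ℚₚ.+-identityˡ _) (ℚₚ.*-zeroʳ (powℕ q (suc (suc k)))))
  pascal′ (suc n) zero    = begin
    powℕ q (suc n) * 1ℚ + suc n C 1
      ≡⟨ cong (_+_ (powℕ q (suc n) * 1ℚ)) (pascal′ n 0) ⟩
    powℕ q (suc n) * 1ℚ + (n C 0 + powℕ q 1 * n C 1)
      ≡⟨ cong (λ c → powℕ q (suc n) * 1ℚ + (c + powℕ q 1 * n C 1)) (nC0≡1 n) ⟩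
    q * powℕ q n * 1ℚ + (1ℚ + q * 1ℚ * n C 1)
      ≡⟨ regroup q (powℕ q n) (n C 1) ⟩
    1ℚ + q * 1ℚ * (powℕ q n * 1ℚ + n C 1)
      ≡⟨ cong (λ c → 1ℚ + q * 1ℚ * (powℕ q n * c + n C 1)) (nC0≡1 n) ⟨
    1ℚ + powℕ q 1 * (powℕ q n * n C 0 + n C 1)
      ∎
    where
    regroup : ∀ q p c → q * p * 1ℚ + (1ℚ + q * 1ℚ * c) ≡ 1ℚ + q * 1ℚ * (p * 1ℚ + c)
    regroup = solve-∀ ℚ-ring
  pascal′ (suc n) (suc k) = begin
    A * suc n C suc k + suc n C suc (suc k)
      ≡⟨ cong₂ (λ x y → A * x + y) (pascal′ n k) (pascal′ n (suc k)) ⟩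
    A * (b₀ + D * b₁) + (b₁ + q * D * b₂)
      ≡⟨ expand A b₀ D b₁ (q * D * b₂) ⟩
    A * b₀ + D * (A * b₁) + b₁ + q * D * b₂
      ≡⟨ cong (λ x → A * b₀ + D * x + b₁ + q * D * b₂) (∸-shift (powℕ q) n k) ⟩
    A * b₀ + D * (q * A′ * b₁) + b₁ + q * D * b₂
      ≡⟨ collect A b₀ D q A′ b₁ b₂ ⟩
    A * b₀ + b₁ + q * D * (A′ * b₁ + b₂)
      ∎
    where
    A = powℕ q (n ∸ k)
    A′ = powℕ q (n ∸ suc k)
    D = powℕ q (suc k)
    b₀ = n C k
    b₁ = n C suc k
    b₂ = n C suc (suc k)
    expand : ∀ a b₀ d b₁ e → a * (b₀ + d * b₁) + (b₁ + e) ≡ a * b₀ + d * (a * b₁) + b₁ + e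
    expand = solve-∀ ℚ-ring
    collect : ∀ a b₀ d q c b₁ b₂ →
              a * b₀ + d * (q * c * b₁) + b₁ + q * d * b₂ ≡ a * b₀ + b₁ + q * d * (c * b₁ + b₂)
    collect = solve-∀ ℚ-ring

  ∑-pascal : ∀ n (a : ℕ → ℚ) →
             ∑[ k < suc (suc n) ] (a k * suc n C k) ≡
             ∑[ k < suc n ] (a k * n C k) + ∑[ k < suc n ] (a (suc k) * powℕ q (n ∸ k) * n C k)
  ∑-pascal n a = begin
    ∑[ k < suc (suc n) ] (a k * suc n C k)
      ≡⟨ ∑-sucˡ (suc n) _ ⟩
    a 0 * 1ℚ + ∑[ k < suc n ] (a (suc k) * (powℕ q (n ∸ k) * n C k + n C suc k))
      ≡⟨ cong (_+_ (a 0 * 1ℚ)) (trans (∑-cong (suc n) (λ k _ → distrib (a (suc k)) _ _ _))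
                                       (∑-distrib-+ (suc n) _ _)) ⟩
    a 0 * 1ℚ + (S₀ + ∑[ k < suc n ] (a (suc k) * n C suc k))
      ≡⟨ swap (a 0 * 1ℚ) S₀ _ ⟩
    a 0 * 1ℚ + ∑[ k < suc n ] (a (suc k) * n C suc k) + S₀
      ≡⟨ cong (λ c → a 0 * c + ∑[ k < suc n ] (a (suc k) * n C suc k) + S₀) (nC0≡1 n) ⟨
    a 0 * n C 0 + ∑[ k < suc n ] (a (suc k) * n C suc k) + S₀
      ≡⟨ cong (_+ S₀) (∑-sucˡ (suc n) (λ k → a k * n C k)) ⟨
    ∑[ k < suc (suc n) ] (a k * n C k) + S₀
      ≡⟨ cong (λ c → ∑[ k < suc n ] (a k * n C k) + a (suc n) * c + S₀) (n<k⇒nCk≡0 (ℕₚ.n<1+n n)) ⟩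
    ∑[ k < suc n ] (a k * n C k) + a (suc n) * 0ℚ + S₀
      ≡⟨ cong (_+ S₀) (trans (cong (_+_ S) (ℚₚ.*-zeroʳ (a (suc n)))) (ℚₚ.+-identityʳ S)) ⟩
    ∑[ k < suc n ] (a k * n C k) + S₀
      ∎
    where
    S  = ∑[ k < suc n ] (a k * n C k)
    S₀ = ∑[ k < suc n ] (a (suc k) * powℕ q (n ∸ k) * n C k)
    distrib : ∀ a p b c → a * (p * b + c) ≡ a * p * b + a * c
    distrib = solve-∀ ℚ-ring
    swap : ∀ x y z → x + (y + z) ≡ x + z + y
    swap = solve-∀ ℚ-ring

  [k+b]Ck≡[k+b]Cb : ∀ k b → (k ℕ.+ b) C k ≡ (k ℕ.+ b) C b
  [k+b]Ck≡[k+b]Cb zero    b       = trans (nC0≡1 b) (sym (nCn≡1 b))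
  [k+b]Ck≡[k+b]Cb (suc k) zero    = trans (cong (λ n → n C suc k) (ℕₚ.+-identityʳ (suc k))) (nCn≡1 (suc k))
  [k+b]Ck≡[k+b]Cb (suc k) (suc b) = begin
    powℕ q (n ∸ k) * n C k + n C suc k     ≡⟨ cong₂ (λ e c → powℕ q e * c + n C suc k) (ℕₚ.m+n∸m≡n k (suc b))
                                                     ([k+b]Ck≡[k+b]Cb k (suc b)) ⟩
    powℕ q (suc b) * n C suc b + n C suc k ≡⟨ cong (_+_ (powℕ q (suc b) * n C suc b)) nC[1+k]≡nCb ⟩
    powℕ q (suc b) * n C suc b + n C b     ≡⟨ ℚₚ.+-comm _ (n C b) ⟩
    n C b + powℕ q (suc b) * n C suc b     ≡⟨ pascal′ n b ⟨
    suc n C suc b                          ∎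
    where
    n = k ℕ.+ suc b
    nC[1+k]≡nCb : n C suc k ≡ n C b
    nC[1+k]≡nCb = subst (λ m → m C suc k ≡ m C b) (sym (ℕₚ.+-suc k b)) ([k+b]Ck≡[k+b]Cb (suc k) b)

  pascal′-∸ : ∀ n k m → n C suc k * (n ∸ k) C suc m ≡
                         n C suc k * (n ∸ suc k) C m + powℕ q (suc m) * (n C suc k * (n ∸ suc k) C suc m)
  pascal′-∸ n k m = begin
    n C suc k * (n ∸ k) C suc m             ≡⟨ ℚₚ.*-comm (n C suc k) _ ⟩
    (n ∸ k) C suc m * n C suc k             ≡⟨ ∸-shift (_C suc m) n k ⟩
    suc (n ∸ suc k) C suc m * n C suc k     ≡⟨ ℚₚ.*-comm _ (n C suc k) ⟩
    n C suc k * suc (n ∸ suc k) C suc m     ≡⟨ cong (_*_ (n C suc k)) (pascal′ (n ∸ suc k) m) ⟩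
    n C suc k * ((n ∸ suc k) C m + powℕ q (suc m) * (n ∸ suc k) C suc m)
      ≡⟨ distribˡ (n C suc k) ((n ∸ suc k) C m) (powℕ q (suc m)) ((n ∸ suc k) C suc m) ⟩
    n C suc k * (n ∸ suc k) C m + powℕ q (suc m) * (n C suc k * (n ∸ suc k) C suc m)
      ∎
    where
    distribˡ : ∀ a b p c → a * (b + p * c) ≡ a * b + p * (a * c)
    distribˡ = solve-∀ ℚ-ring

  nCk*[n∸k]Cm≡nC[k+m]*[k+m]Ck : ∀ n k m → n C k * (n ∸ k) C m ≡ n C (k ℕ.+ m) * (k ℕ.+ m) C k
  nCk*[n∸k]Cm≡nC[k+m]*[k+m]Ck zero    zero    zero    = refl
  nCk*[n∸k]Cm≡nC[k+m]*[k+m]Ck zero    zero    (suc m) = refl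
  nCk*[n∸k]Cm≡nC[k+m]*[k+m]Ck zero    (suc k) m       =
    trans (ℚₚ.*-zeroˡ (0 C m)) (sym (ℚₚ.*-zeroˡ ((suc k ℕ.+ m) C suc k)))
  nCk*[n∸k]Cm≡nC[k+m]*[k+m]Ck (suc n) zero    m       = begin
    1ℚ * suc n C m         ≡⟨ ℚₚ.*-identityˡ _ ⟩
    suc n C m              ≡⟨ ℚₚ.*-identityʳ _ ⟨
    suc n C m * 1ℚ         ≡⟨ cong (_*_ (suc n C m)) (nC0≡1 m) ⟨
    suc n C m * m C 0      ∎
  nCk*[n∸k]Cm≡nC[k+m]*[k+m]Ck (suc n) (suc k) zero    = begin
    suc n C suc k * (n ∸ k) C 0                   ≡⟨ cong (_*_ (suc n C suc k)) (nC0≡1 (n ∸ k)) ⟩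
    suc n C suc k * 1ℚ                            ≡⟨ cong (_*_ (suc n C suc k)) (nCn≡1 (suc k)) ⟨
    suc n C suc k * suc k C suc k                 ≡⟨ cong (λ j → suc n C j * j C suc k) (ℕₚ.+-identityʳ (suc k)) ⟨
    suc n C (suc k ℕ.+ 0) * (suc k ℕ.+ 0) C suc k ∎
  nCk*[n∸k]Cm≡nC[k+m]*[k+m]Ck (suc n) (suc k) (suc m) = begin
    suc n C suc k * (n ∸ k) C suc m
      ≡⟨ cong (_* (n ∸ k) C suc m) (pascal′ n k) ⟩
    (n C k + powℕ q (suc k) * n C suc k) * (n ∸ k) C suc m
      ≡⟨ distribʳ (n C k) (powℕ q (suc k)) (n C suc k) ((n ∸ k) C suc m) ⟩
    n C k * (n ∸ k) C suc m + powℕ q (suc k) * (n C suc k * (n ∸ k) C suc m)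
      ≡⟨ cong₂ (λ x y → x + powℕ q (suc k) * y) (nCk*[n∸k]Cm≡nC[k+m]*[k+m]Ck n k (suc m)) (pascal′-∸ n k m) ⟩
    n C s * s C k + powℕ q (suc k) * (n C suc k * (n ∸ suc k) C m + powℕ q (suc m) * (n C suc k * (n ∸ suc k) C suc m))
      ≡⟨ cong₂ (λ x y → n C s * s C k + powℕ q (suc k) * (x + powℕ q (suc m) * y))
               (trans (nCk*[n∸k]Cm≡nC[k+m]*[k+m]Ck n (suc k) m) (cong (λ j → n C j * j C suc k) (sym (ℕₚ.+-suc k m))))
               (nCk*[n∸k]Cm≡nC[k+m]*[k+m]Ck n (suc k) (suc m)) ⟩
    n C s * s C k + powℕ q (suc k) * (n C s * s C suc k + powℕ q (suc m) * X)
      ≡⟨ regroup (n C s) (s C k) (powℕ q (suc k)) (s C suc k) (powℕ q (suc m)) X ⟩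
    n C s * (s C k + powℕ q (suc k) * s C suc k) + powℕ q (suc k) * powℕ q (suc m) * X
      ≡⟨ cong₂ (λ x y → n C s * x + y * X) (pascal′ s k) (powℕ-+ q (suc k) (suc m)) ⟨
    n C s * suc s C suc k + powℕ q (suc s) * (n C suc s * suc s C suc k)
      ≡⟨ factor (n C s) (suc s C suc k) (powℕ q (suc s)) (n C suc s) ⟩
    (n C s + powℕ q (suc s) * n C suc s) * suc s C suc k
      ≡⟨ cong (_* suc s C suc k) (pascal′ n s) ⟨
    suc n C suc s * suc s C suc k
      ∎
    where
    s = k ℕ.+ suc m
    X = n C suc s * suc s C suc k
    distribʳ : ∀ a p b c → (a + p * b) * c ≡ a * c + p * (b * c)
    distribʳ = solve-∀ ℚ-ring
    regroup : ∀ a b p c r x → a * b + p * (a * c + r * x) ≡ a * (b + p * c) + p * r * x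
    regroup = solve-∀ ℚ-ring
    factor : ∀ a b p c → a * b + p * (c * b) ≡ (a + p * c) * b
    factor = solve-∀ ℚ-ring

  nCk*[n∸k]Cm≡nCm*[n∸m]Ck : ∀ n k m → n C k * (n ∸ k) C m ≡ n C m * (n ∸ m) C k
  nCk*[n∸k]Cm≡nCm*[n∸m]Ck n k m = begin
    n C k * (n ∸ k) C m                 ≡⟨ nCk*[n∸k]Cm≡nC[k+m]*[k+m]Ck n k m ⟩
    n C (k ℕ.+ m) * (k ℕ.+ m) C k       ≡⟨ cong (_*_ (n C (k ℕ.+ m))) ([k+b]Ck≡[k+b]Cb k m) ⟩
    n C (k ℕ.+ m) * (k ℕ.+ m) C m       ≡⟨ cong (λ j → n C j * j C m) (ℕₚ.+-comm k m) ⟩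
    n C (m ℕ.+ k) * (m ℕ.+ k) C m       ≡⟨ nCk*[n∸k]Cm≡nC[k+m]*[k+m]Ck n m k ⟨
    n C m * (n ∸ m) C k                 ∎

  [k+d]Ck*qPoch≡qPoch : ∀ k d → (k ℕ.+ d) C k * (qPoch q k * qPoch q d) ≡ qPoch q (k ℕ.+ d)
  [k+d]Ck*qPoch≡qPoch zero    d       = begin
    d C 0 * (1ℚ * qPoch q d) ≡⟨ cong (_* (1ℚ * qPoch q d)) (nC0≡1 d) ⟩
    1ℚ * (1ℚ * qPoch q d)    ≡⟨ trans (ℚₚ.*-identityˡ _) (ℚₚ.*-identityˡ _) ⟩
    qPoch q d                ∎
  [k+d]Ck*qPoch≡qPoch (suc k) zero    = begin
    (suc k ℕ.+ 0) C suc k * (qPoch q (suc k) * 1ℚ)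
      ≡⟨ cong (λ n → n C suc k * (qPoch q (suc k) * 1ℚ)) (ℕₚ.+-identityʳ (suc k)) ⟩
    suc k C suc k * (qPoch q (suc k) * 1ℚ)
      ≡⟨ cong (_* (qPoch q (suc k) * 1ℚ)) (nCn≡1 (suc k)) ⟩
    1ℚ * (qPoch q (suc k) * 1ℚ)
      ≡⟨ trans (ℚₚ.*-identityˡ _) (ℚₚ.*-identityʳ _) ⟩
    qPoch q (suc k)
      ≡⟨ cong (qPoch q) (ℕₚ.+-identityʳ (suc k)) ⟨
    qPoch q (suc k ℕ.+ 0)
      ∎
  [k+d]Ck*qPoch≡qPoch (suc k) (suc d) = begin
    (powℕ q (n ∸ k) * n C k + n C suc k) * (qPoch q k * fₖ * (qPoch q d * f_d))
      ≡⟨ cong (λ e → (powℕ q e * n C k + n C suc k) * (qPoch q k * fₖ * (qPoch q d * f_d))) (ℕₚ.m+n∸m≡n k (suc d)) ⟩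
    (q * powℕ q d * n C k + n C suc k) * (qPoch q k * fₖ * (qPoch q d * f_d))
      ≡⟨ split q (powℕ q d) (n C k) (n C suc k) (qPoch q k) fₖ (qPoch q d) f_d ⟩
    q * powℕ q d * fₖ * (n C k * (qPoch q k * (qPoch q d * f_d))) + f_d * (n C suc k * (qPoch q k * fₖ * qPoch q d))
      ≡⟨ cong₂ (λ x y → q * powℕ q d * fₖ * x + f_d * y) ([k+d]Ck*qPoch≡qPoch k (suc d)) shifted ⟩
    q * powℕ q d * fₖ * qPoch q n + f_d * qPoch q n
      ≡⟨ collect q (powℕ q d) (powℕ q k) (qPoch q n) ⟩
    qPoch q n * (1ℚ + - (q * (powℕ q k * (q * powℕ q d))))
      ≡⟨ cong (λ x → qPoch q n * (1ℚ + - (q * x))) (powℕ-+ q k (suc d)) ⟨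
    qPoch q n * (1ℚ + - (q * powℕ q n))
      ∎
    where
    n = k ℕ.+ suc d
    fₖ = 1ℚ + - (q * powℕ q k)
    f_d = 1ℚ + - (q * powℕ q d)
    shifted : n C suc k * (qPoch q k * fₖ * qPoch q d) ≡ qPoch q n
    shifted = subst (λ m → m C suc k * (qPoch q k * fₖ * qPoch q d) ≡ qPoch q m)
                    (sym (ℕₚ.+-suc k d)) ([k+d]Ck*qPoch≡qPoch (suc k) d)
    split : ∀ q p b₀ b₁ P fₖ Q f_d →
            (q * p * b₀ + b₁) * (P * fₖ * (Q * f_d)) ≡
            q * p * fₖ * (b₀ * (P * (Q * f_d))) + f_d * (b₁ * (P * fₖ * Q))
    split = solve-∀ ℚ-ring
    collect : ∀ q p r X → q * p * (1ℚ + - (q * r)) * X + (1ℚ + - (q * p)) * X ≡ X * (1ℚ + - (q * (r * (q * p))))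
    collect = solve-∀ ℚ-ring

  qBin≡C : ∀ n k → (∀ m → m ≤ n → qPoch q m ≢ 0ℚ) → qBin q (+ n) (+ k) ≡ n C k
  qBin≡C n k poch≢0 with k ℕₚ.≤? n
  ... | yes k≤n = begin
    qPoch q n * inv P
      ≡⟨ cong (λ m → qPoch q m * inv P) (ℕₚ.m+[n∸m]≡n k≤n) ⟨
    qPoch q (k ℕ.+ (n ∸ k)) * inv P
      ≡⟨ cong (_* inv P) ([k+d]Ck*qPoch≡qPoch k (n ∸ k)) ⟨
    (k ℕ.+ (n ∸ k)) C k * P * inv P
      ≡⟨ cong (λ m → m C k * P * inv P) (ℕₚ.m+[n∸m]≡n k≤n) ⟩
    n C k * P * inv P
      ≡⟨ ℚₚ.*-assoc (n C k) P (inv P) ⟩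
    n C k * (P * inv P)
      ≡⟨ cong (_*_ (n C k)) (inv-inverseʳ (*-≢0 (poch≢0 k k≤n) (poch≢0 (n ∸ k) (ℕₚ.m∸n≤m n k)))) ⟩
    n C k * 1ℚ
      ≡⟨ ℚₚ.*-identityʳ (n C k) ⟩
    n C k
      ∎
    where P = qPoch q k * qPoch q (n ∸ k)
  ... | no  k≰n = sym (n<k⇒nCk≡0 (ℕₚ.≰⇒> k≰n))

  -- Rothe's q-binomial theorem evaluates this to q^(T x) (q^(x+1);q)_M.
  rothe : ℤ → ℕ → ℚ
  rothe x M = ∑[ r < suc M ] (sgn r * powℕ q (triℤ (x ℤ.+ + r)) * M C r)

  rothe-suc : ∀ x M e → + e ≡ x ℤ.+ + suc M → rothe x (suc M) ≡ (1ℚ + - powℕ q e) * rothe x M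
  rothe-suc x M e e≡ = begin
    rothe x (suc M)
      ≡⟨ ∑-pascal M a ⟩
    rothe x M + ∑[ r < suc M ] (a (suc r) * powℕ q (M ∸ r) * M C r)
      ≡⟨ cong (_+_ (rothe x M)) (∑-cong (suc M) shift) ⟩
    rothe x M + ∑[ r < suc M ] (- powℕ q e * (a r * M C r))
      ≡⟨ cong (_+_ (rothe x M)) (*-distribˡ-∑ (suc M) (- powℕ q e) _) ⟨
    rothe x M + - powℕ q e * rothe x M
      ≡⟨ factor (rothe x M) (powℕ q e) ⟩
    (1ℚ + - powℕ q e) * rothe x M
      ∎
    where
    a : ℕ → ℚ
    a r = sgn r * powℕ q (triℤ (x ℤ.+ + r))
    factor : ∀ y p → y + - p * y ≡ (1ℚ + - p) * y
    factor = solve-∀ ℚ-ring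
    regroup : ∀ s t p c → - 1ℚ * s * t * p * c ≡ - 1ℚ * s * (t * p) * c
    regroup = solve-∀ ℚ-ring
    move : ∀ s t p c → - 1ℚ * s * (t * p) * c ≡ - p * (s * t * c)
    move = solve-∀ ℚ-ring
    shift : ∀ r → r < suc M → a (suc r) * powℕ q (M ∸ r) * M C r ≡ - powℕ q e * (a r * M C r)
    shift r (s≤s r≤M) = begin
      - 1ℚ * sgn r * powℕ q (triℤ (x ℤ.+ + suc r)) * powℕ q (M ∸ r) * M C r
        ≡⟨ regroup (sgn r) _ _ (M C r) ⟩
      - 1ℚ * sgn r * (powℕ q (triℤ (x ℤ.+ + suc r)) * powℕ q (M ∸ r)) * M C r
        ≡⟨ cong (λ y → - 1ℚ * sgn r * y * M C r) (powℕ-+ q (triℤ (x ℤ.+ + suc r)) (M ∸ r)) ⟨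
      - 1ℚ * sgn r * powℕ q (triℤ (x ℤ.+ + suc r) ℕ.+ (M ∸ r)) * M C r
        ≡⟨ cong (λ k → - 1ℚ * sgn r * powℕ q k * M C r) (triℤ-step x r (M ∸ r) e e≡′) ⟩
      - 1ℚ * sgn r * powℕ q (triℤ (x ℤ.+ + r) ℕ.+ e) * M C r
        ≡⟨ cong (λ y → - 1ℚ * sgn r * y * M C r) (powℕ-+ q (triℤ (x ℤ.+ + r)) e) ⟩
      - 1ℚ * sgn r * (powℕ q (triℤ (x ℤ.+ + r)) * powℕ q e) * M C r
        ≡⟨ move (sgn r) _ (powℕ q e) (M C r) ⟩
      - powℕ q e * (a r * M C r)
        ∎
      where
      e≡′ : + e ≡ x ℤ.+ + suc (r ℕ.+ (M ∸ r))
      e≡′ = trans e≡ (cong (λ m → x ℤ.+ + suc m) (sym (ℕₚ.m+[n∸m]≡n r≤M)))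

  qPoch*rothe : ∀ c M → qPoch q c * rothe (+ c) M ≡ powℕ q (tri c) * qPoch q (c ℕ.+ M)
  qPoch*rothe c zero    = begin
    qPoch q c * (0ℚ + 1ℚ * powℕ q (tri (c ℕ.+ 0)) * 1ℚ)
      ≡⟨ cong (λ m → qPoch q c * (0ℚ + 1ℚ * powℕ q (tri m) * 1ℚ)) (ℕₚ.+-identityʳ c) ⟩
    qPoch q c * (0ℚ + 1ℚ * powℕ q (tri c) * 1ℚ)
      ≡⟨ tidy (qPoch q c) (powℕ q (tri c)) ⟩
    powℕ q (tri c) * qPoch q c
      ≡⟨ cong (λ m → powℕ q (tri c) * qPoch q m) (ℕₚ.+-identityʳ c) ⟨
    powℕ q (tri c) * qPoch q (c ℕ.+ 0)
      ∎
    where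
    tidy : ∀ P t → P * (0ℚ + 1ℚ * t * 1ℚ) ≡ t * P
    tidy = solve-∀ ℚ-ring
  qPoch*rothe c (suc M) = begin
    qPoch q c * rothe (+ c) (suc M)
      ≡⟨ cong (_*_ (qPoch q c)) (rothe-suc (+ c) M (c ℕ.+ suc M) refl) ⟩
    qPoch q c * ((1ℚ + - powℕ q (c ℕ.+ suc M)) * rothe (+ c) M)
      ≡⟨ swap (qPoch q c) _ (rothe (+ c) M) ⟩
    qPoch q c * rothe (+ c) M * (1ℚ + - powℕ q (c ℕ.+ suc M))
      ≡⟨ cong (_* (1ℚ + - powℕ q (c ℕ.+ suc M))) (qPoch*rothe c M) ⟩
    powℕ q (tri c) * qPoch q (c ℕ.+ M) * (1ℚ + - powℕ q (c ℕ.+ suc M))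
      ≡⟨ ℚₚ.*-assoc (powℕ q (tri c)) _ _ ⟩
    powℕ q (tri c) * (qPoch q (c ℕ.+ M) * (1ℚ + - powℕ q (c ℕ.+ suc M)))
      ≡⟨ cong (λ m → powℕ q (tri c) * (qPoch q (c ℕ.+ M) * (1ℚ + - powℕ q m))) (ℕₚ.+-suc c M) ⟩
    powℕ q (tri c) * qPoch q (suc (c ℕ.+ M))
      ≡⟨ cong (λ m → powℕ q (tri c) * qPoch q m) (ℕₚ.+-suc c M) ⟨
    powℕ q (tri c) * qPoch q (c ℕ.+ suc M)
      ∎
    where
    swap : ∀ P f y → P * (f * y) ≡ P * y * f
    swap = solve-∀ ℚ-ring

  rothe-neg : ∀ a M → a < M → rothe -[1+ a ] M ≡ 0ℚ
  rothe-neg a (suc M) (s≤s a≤M) = begin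
    rothe -[1+ a ] (suc M)                             ≡⟨ rothe-suc -[1+ a ] M (M ∸ a) e≡ ⟩
    (1ℚ + - powℕ q (M ∸ a)) * rothe -[1+ a ] M         ≡⟨ vanish (ℕₚ.m≤n⇒m<n∨m≡n a≤M) ⟩
    0ℚ                                                 ∎
    where
    e≡ : + (M ∸ a) ≡ -[1+ a ] ℤ.+ + suc M
    e≡ = sym (trans (ℤₚ.[1+m]⊖[1+n]≡m⊖n M a) (ℤₚ.⊖-≥ a≤M))
    vanish : a < M ⊎ a ≡ M → (1ℚ + - powℕ q (M ∸ a)) * rothe -[1+ a ] M ≡ 0ℚ
    vanish (inj₁ a<M) = trans (cong (_*_ (1ℚ + - powℕ q (M ∸ a))) (rothe-neg a M a<M))
                              (ℚₚ.*-zeroʳ (1ℚ + - powℕ q (M ∸ a)))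
    vanish (inj₂ refl) = trans (cong (λ m → (1ℚ + - powℕ q m) * rothe -[1+ a ] a) (ℕₚ.n∸n≡0 a))
                               (ℚₚ.*-zeroˡ (rothe -[1+ a ] a))

  -- The a-th q-difference of n ↦ n C c, evaluated at n = M.
  qΔ : ℕ → ℕ → ℕ → ℚ
  qΔ a M c = ∑[ k < suc a ] (sgn k * powℕ q (choose2 k) * (M ∸ k) C c * a C k)

  qΔ-suc : ∀ a M c → qΔ (suc a) M c ≡ qΔ a M c + - (powℕ q a * qΔ a (M ∸ 1) c)
  qΔ-suc a M c = begin
    qΔ (suc a) M c
      ≡⟨ ∑-pascal a b ⟩
    qΔ a M c + ∑[ k < suc a ] (b (suc k) * powℕ q (a ∸ k) * a C k)
      ≡⟨ cong (_+_ (qΔ a M c)) (∑-cong (suc a) shift) ⟩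
    qΔ a M c + ∑[ k < suc a ] (- powℕ q a * b′ k)
      ≡⟨ cong (_+_ (qΔ a M c)) (*-distribˡ-∑ (suc a) (- powℕ q a) b′) ⟨
    qΔ a M c + - powℕ q a * qΔ a (M ∸ 1) c
      ≡⟨ cong (_+_ (qΔ a M c)) (ℚₚ.neg-distribˡ-* (powℕ q a) _) ⟨
    qΔ a M c + - (powℕ q a * qΔ a (M ∸ 1) c)
      ∎
    where
    b : ℕ → ℚ
    b k = sgn k * powℕ q (choose2 k) * (M ∸ k) C c
    b′ : ℕ → ℚ
    b′ k = sgn k * powℕ q (choose2 k) * ((M ∸ 1) ∸ k) C c * a C k
    regroup : ∀ s t p x y → - 1ℚ * s * t * x * p * y ≡ - 1ℚ * s * (t * p) * x * y
    regroup = solve-∀ ℚ-ring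
    move : ∀ s t p x y → - 1ℚ * s * (t * p) * x * y ≡ - p * (s * t * x * y)
    move = solve-∀ ℚ-ring
    shift : ∀ k → k < suc a → b (suc k) * powℕ q (a ∸ k) * a C k ≡ - powℕ q a * b′ k
    shift k (s≤s k≤a) = begin
      - 1ℚ * sgn k * powℕ q (k ℕ.+ choose2 k) * (M ∸ suc k) C c * powℕ q (a ∸ k) * a C k
        ≡⟨ regroup (sgn k) _ (powℕ q (a ∸ k)) ((M ∸ suc k) C c) (a C k) ⟩
      - 1ℚ * sgn k * (powℕ q (k ℕ.+ choose2 k) * powℕ q (a ∸ k)) * (M ∸ suc k) C c * a C k
        ≡⟨ cong₂ (λ y n → - 1ℚ * sgn k * y * n C c * a C k) exponent (sym (ℕₚ.∸-+-assoc M 1 k)) ⟩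
      - 1ℚ * sgn k * (powℕ q (choose2 k) * powℕ q a) * ((M ∸ 1) ∸ k) C c * a C k
        ≡⟨ move (sgn k) (powℕ q (choose2 k)) (powℕ q a) _ (a C k) ⟩
      - powℕ q a * b′ k
        ∎
      where
      exponent : powℕ q (k ℕ.+ choose2 k) * powℕ q (a ∸ k) ≡ powℕ q (choose2 k) * powℕ q a
      exponent = powℕ-tri-shift q k 0 a (subst (_≤ a) (sym (ℕₚ.+-identityʳ k)) k≤a)

  qΔ-diag : ∀ a w d → qΔ a (a ℕ.+ w) (a ℕ.+ d) ≡ powℕ q (a ℕ.* (w ∸ d)) * w C d
  qΔ-diag zero    w d = tidy (w C d)
    where
    tidy : ∀ b → 0ℚ + 1ℚ * 1ℚ * b * 1ℚ ≡ 1ℚ * b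
    tidy = solve-∀ ℚ-ring
  qΔ-diag (suc a) w d = begin
    qΔ (suc a) (suc a ℕ.+ w) (suc a ℕ.+ d)
      ≡⟨ qΔ-suc a (suc a ℕ.+ w) (suc a ℕ.+ d) ⟩
    qΔ a (suc a ℕ.+ w) (suc a ℕ.+ d) + - (powℕ q a * qΔ a (a ℕ.+ w) (suc a ℕ.+ d))
      ≡⟨ cong₂ (λ u v → qΔ a u v + - (powℕ q a * qΔ a (a ℕ.+ w) v)) (sym (ℕₚ.+-suc a w)) (sym (ℕₚ.+-suc a d)) ⟩
    qΔ a (a ℕ.+ suc w) (a ℕ.+ suc d) + - (powℕ q a * qΔ a (a ℕ.+ w) (a ℕ.+ suc d))
      ≡⟨ cong₂ (λ u v → u + - (powℕ q a * v)) (qΔ-diag a (suc w) (suc d)) (qΔ-diag a w (suc d)) ⟩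
    X * (powℕ q (w ∸ d) * w C d + w C suc d) + - (powℕ q a * (powℕ q (a ℕ.* (w ∸ suc d)) * w C suc d))
      ≡⟨ cong (λ y → X * (powℕ q (w ∸ d) * w C d + w C suc d) + - y) shifted ⟨
    X * (powℕ q (w ∸ d) * w C d + w C suc d) + - (X * w C suc d)
      ≡⟨ cancel X (powℕ q (w ∸ d)) (w C d) (w C suc d) ⟩
    powℕ q (w ∸ d) * X * w C d
      ≡⟨ cong (_* w C d) (powℕ-+ q (w ∸ d) (a ℕ.* (w ∸ d))) ⟨
    powℕ q (suc a ℕ.* (w ∸ d)) * w C d
      ∎
    where
    X = powℕ q (a ℕ.* (w ∸ d))
    cancel : ∀ x p b b′ → x * (p * b + b′) + - (x * b′) ≡ p * x * b
    cancel = solve-∀ ℚ-ring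
    shifted : X * w C suc d ≡ powℕ q a * (powℕ q (a ℕ.* (w ∸ suc d)) * w C suc d)
    shifted = begin
      X * w C suc d
        ≡⟨ ∸-shift (λ e → powℕ q (a ℕ.* e)) w d ⟩
      powℕ q (a ℕ.* suc (w ∸ suc d)) * w C suc d
        ≡⟨ cong (λ e → powℕ q e * w C suc d) (ℕₚ.*-suc a (w ∸ suc d)) ⟩
      powℕ q (a ℕ.+ a ℕ.* (w ∸ suc d)) * w C suc d
        ≡⟨ cong (_* w C suc d) (powℕ-+ q a (a ℕ.* (w ∸ suc d))) ⟩
      powℕ q a * powℕ q (a ℕ.* (w ∸ suc d)) * w C suc d
        ≡⟨ ℚₚ.*-assoc (powℕ q a) _ _ ⟩
      powℕ q a * (powℕ q (a ℕ.* (w ∸ suc d)) * w C suc d)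
        ∎

  qΔ-below : ∀ a w c → c < a → qΔ a (a ℕ.+ w) c ≡ 0ℚ
  qΔ-below (suc a) w c (s≤s c≤a) = begin
    qΔ (suc a) (suc a ℕ.+ w) c
      ≡⟨ qΔ-suc a (suc a ℕ.+ w) c ⟩
    qΔ a (suc a ℕ.+ w) c + - (powℕ q a * qΔ a (a ℕ.+ w) c)
      ≡⟨ cong (λ u → qΔ a u c + - (powℕ q a * qΔ a (a ℕ.+ w) c)) (sym (ℕₚ.+-suc a w)) ⟩
    qΔ a (a ℕ.+ suc w) c + - (powℕ q a * qΔ a (a ℕ.+ w) c)
      ≡⟨ vanish (ℕₚ.m≤n⇒m<n∨m≡n c≤a) ⟩
    0ℚ
      ∎
    where
    vanish : c < a ⊎ c ≡ a → qΔ a (a ℕ.+ suc w) c + - (powℕ q a * qΔ a (a ℕ.+ w) c) ≡ 0ℚ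
    vanish (inj₁ c<a) = begin
      qΔ a (a ℕ.+ suc w) c + - (powℕ q a * qΔ a (a ℕ.+ w) c)
        ≡⟨ cong₂ (λ u v → u + - (powℕ q a * v)) (qΔ-below a (suc w) c c<a) (qΔ-below a w c c<a) ⟩
      0ℚ + - (powℕ q a * 0ℚ)
        ≡⟨ cong (λ y → 0ℚ + - y) (ℚₚ.*-zeroʳ (powℕ q a)) ⟩
      0ℚ
        ∎
    vanish (inj₂ refl) = begin
      qΔ c (c ℕ.+ suc w) c + - (powℕ q c * qΔ c (c ℕ.+ w) c)
        ≡⟨ cong₂ (λ u v → qΔ c (c ℕ.+ suc w) u + - (powℕ q c * qΔ c (c ℕ.+ w) v)) c≡c+0 c≡c+0 ⟩
      qΔ c (c ℕ.+ suc w) (c ℕ.+ 0) + - (powℕ q c * qΔ c (c ℕ.+ w) (c ℕ.+ 0))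
        ≡⟨ cong₂ (λ u v → u + - (powℕ q c * v)) (qΔ-diag c (suc w) 0) (qΔ-diag c w 0) ⟩
      powℕ q (c ℕ.* suc w) * 1ℚ + - (powℕ q c * (powℕ q (c ℕ.* w) * w C 0))
        ≡⟨ cong₂ (λ u v → u * 1ℚ + - (powℕ q c * (powℕ q (c ℕ.* w) * v)))
                 (trans (cong (powℕ q) (ℕₚ.*-suc c w)) (powℕ-+ q c (c ℕ.* w))) (nC0≡1 w) ⟩
      powℕ q c * powℕ q (c ℕ.* w) * 1ℚ + - (powℕ q c * (powℕ q (c ℕ.* w) * 1ℚ))
        ≡⟨ cancel (powℕ q c) (powℕ q (c ℕ.* w)) ⟩
      0ℚ ∎
      where
      c≡c+0 = sym (ℕₚ.+-identityʳ c)
      cancel : ∀ x y → x * y * 1ℚ + - (x * (y * 1ℚ)) ≡ 0ℚ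
      cancel = solve-∀ ℚ-ring

  K : ℕ → ℕ → ℕ → ℚ
  K b a m = ∑[ k < suc m ] (sgn k * powℕ q (tri k) * a C k * (m ∸ k) C b)

  K-increment-term : ∀ a c m k → k ≤ m →
                     sgn k * powℕ q (tri k) * a C k * (powℕ q (m ∸ k ∸ c) * (m ∸ k) C c) ≡
                     powℕ q (m ∸ c) * (sgn k * powℕ q (choose2 k) * (m ∸ k) C c * a C k)
  K-increment-term a c m k k≤m with k ℕ.+ c ℕₚ.≤? m
  ... | yes k+c≤m = begin
    sgn k * powℕ q (tri k) * a C k * (powℕ q (m ∸ k ∸ c) * (m ∸ k) C c)
      ≡⟨ regroup (sgn k) (powℕ q (tri k)) (a C k) (powℕ q (m ∸ k ∸ c)) ((m ∸ k) C c) ⟩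
    sgn k * (powℕ q (tri k) * powℕ q (m ∸ k ∸ c)) * (m ∸ k) C c * a C k
      ≡⟨ cong (λ y → sgn k * y * (m ∸ k) C c * a C k) (powℕ-tri-shift q k c m k+c≤m) ⟩
    sgn k * (powℕ q (choose2 k) * powℕ q (m ∸ c)) * (m ∸ k) C c * a C k
      ≡⟨ move (sgn k) (powℕ q (choose2 k)) (powℕ q (m ∸ c)) ((m ∸ k) C c) (a C k) ⟩
    powℕ q (m ∸ c) * (sgn k * powℕ q (choose2 k) * (m ∸ k) C c * a C k)
      ∎
    where
    regroup : ∀ s t x p y → s * t * x * (p * y) ≡ s * (t * p) * y * x
    regroup = solve-∀ ℚ-ring
    move : ∀ s t p y x → s * (t * p) * y * x ≡ p * (s * t * y * x)
    move = solve-∀ ℚ-ring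
  ... | no  k+c≰m = begin
    sgn k * powℕ q (tri k) * a C k * (powℕ q (m ∸ k ∸ c) * (m ∸ k) C c)
      ≡⟨ cong (λ y → sgn k * powℕ q (tri k) * a C k * (powℕ q (m ∸ k ∸ c) * y)) [m∸k]Cc≡0 ⟩
    sgn k * powℕ q (tri k) * a C k * (powℕ q (m ∸ k ∸ c) * 0ℚ)
      ≡⟨ zeros (sgn k) (powℕ q (tri k)) (a C k) (powℕ q (m ∸ k ∸ c)) (powℕ q (m ∸ c)) (powℕ q (choose2 k)) ⟩
    powℕ q (m ∸ c) * (sgn k * powℕ q (choose2 k) * 0ℚ * a C k)
      ≡⟨ cong (λ y → powℕ q (m ∸ c) * (sgn k * powℕ q (choose2 k) * y * a C k)) [m∸k]Cc≡0 ⟨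
    powℕ q (m ∸ c) * (sgn k * powℕ q (choose2 k) * (m ∸ k) C c * a C k)
      ∎
    where
    [m∸k]Cc≡0 = n<k⇒nCk≡0 (ℕₚ.≰⇒> (λ c≤m∸k →
                  k+c≰m (subst (_≤ m) (ℕₚ.+-comm c k) (ℕₚ.m≤o∸n⇒m+n≤o c k≤m c≤m∸k))))
    zeros : ∀ s t x p r u → s * t * x * (p * 0ℚ) ≡ r * (s * u * 0ℚ * x)
    zeros = solve-∀ ℚ-ring

  -- K (1 + c) a (1 + m) - K (1 + c) a m, by Pascal's rule in the last factor; it equals q^(m-c) qΔ a m c.
  K-increment≡0 : ∀ c a m → c < a → a ≤ m →
                  ∑[ k < suc m ] (sgn k * powℕ q (tri k) * a C k * (powℕ q (m ∸ k ∸ c) * (m ∸ k) C c)) ≡ 0ℚ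
  K-increment≡0 c a m c<a a≤m = begin
    ∑[ k < suc m ] (sgn k * powℕ q (tri k) * a C k * (powℕ q (m ∸ k ∸ c) * (m ∸ k) C c))
      ≡⟨ ∑-cong (suc m) (λ k k≤m → K-increment-term a c m k (ℕₚ.≤-pred k≤m)) ⟩
    ∑[ k < suc m ] (powℕ q (m ∸ c) * Δterm k)
      ≡⟨ *-distribˡ-∑ (suc m) (powℕ q (m ∸ c)) Δterm ⟨
    powℕ q (m ∸ c) * ∑[ k < suc m ] Δterm k
      ≡⟨ cong (_*_ (powℕ q (m ∸ c))) (∑-trim Δterm (s≤s a≤m) (λ k a<k _ →
           trans (cong (_*_ (sgn k * powℕ q (choose2 k) * (m ∸ k) C c)) (n<k⇒nCk≡0 a<k))
                 (ℚₚ.*-zeroʳ (sgn k * powℕ q (choose2 k) * (m ∸ k) C c)))) ⟩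
    powℕ q (m ∸ c) * qΔ a m c
      ≡⟨ cong (λ n → powℕ q (m ∸ c) * qΔ a n c) (ℕₚ.m+[n∸m]≡n a≤m) ⟨
    powℕ q (m ∸ c) * qΔ a (a ℕ.+ (m ∸ a)) c
      ≡⟨ cong (_*_ (powℕ q (m ∸ c))) (qΔ-below a (m ∸ a) c c<a) ⟩
    powℕ q (m ∸ c) * 0ℚ
      ≡⟨ ℚₚ.*-zeroʳ (powℕ q (m ∸ c)) ⟩
    0ℚ
      ∎
    where
    Δterm : ℕ → ℚ
    Δterm k = sgn k * powℕ q (choose2 k) * (m ∸ k) C c * a C k

  K-suc : ∀ b a m → b ≤ a → a ≤ m → K b a (suc m) ≡ K b a m
  K-suc b a m b≤a a≤m = begin
    ∑[ k < suc m ] (cₖ k * (suc m ∸ k) C b) + cₖ (suc m) * (suc m ∸ suc m) C b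
      ≡⟨ cong (λ y → ∑[ k < suc m ] (cₖ k * (suc m ∸ k) C b) + sgn (suc m) * powℕ q (tri (suc m)) * y * (m ∸ m) C b)
              (n<k⇒nCk≡0 (s≤s a≤m)) ⟩
    ∑[ k < suc m ] (cₖ k * (suc m ∸ k) C b) + sgn (suc m) * powℕ q (tri (suc m)) * 0ℚ * (m ∸ m) C b
      ≡⟨ drop _ (sgn (suc m)) (powℕ q (tri (suc m))) ((m ∸ m) C b) ⟩
    ∑[ k < suc m ] (cₖ k * (suc m ∸ k) C b)
      ≡⟨ ∑-cong (suc m) (λ k k≤m → cong (λ n → cₖ k * n C b) (ℕₚ.+-∸-assoc 1 (ℕₚ.≤-pred k≤m))) ⟩
    ∑[ k < suc m ] (cₖ k * suc (m ∸ k) C b)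
      ≡⟨ pascal-step b b≤a ⟩
    K b a m
      ∎
    where
    cₖ : ℕ → ℚ
    cₖ k = sgn k * powℕ q (tri k) * a C k
    drop : ∀ y s t x → y + s * t * 0ℚ * x ≡ y
    drop = solve-∀ ℚ-ring
    split : ∀ x y z → x * (y + z) ≡ x * z + x * y
    split = solve-∀ ℚ-ring
    pascal-step : ∀ b → b ≤ a → ∑[ k < suc m ] (cₖ k * suc (m ∸ k) C b) ≡ K b a m
    pascal-step zero    _   = ∑-cong (suc m) (λ k _ → cong (_*_ (cₖ k)) (sym (nC0≡1 (m ∸ k))))
    pascal-step (suc c) c<a = begin
      ∑[ k < suc m ] (cₖ k * (powℕ q (m ∸ k ∸ c) * (m ∸ k) C c + (m ∸ k) C suc c))
        ≡⟨ ∑-cong (suc m) (λ k _ → split (cₖ k) _ ((m ∸ k) C suc c)) ⟩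
      ∑[ k < suc m ] (cₖ k * (m ∸ k) C suc c + cₖ k * (powℕ q (m ∸ k ∸ c) * (m ∸ k) C c))
        ≡⟨ ∑-distrib-+ (suc m) _ _ ⟩
      K (suc c) a m + ∑[ k < suc m ] (cₖ k * (powℕ q (m ∸ k ∸ c) * (m ∸ k) C c))
        ≡⟨ cong (_+_ (K (suc c) a m)) (K-increment≡0 c a m c<a a≤m) ⟩
      K (suc c) a m + 0ℚ
        ≡⟨ ℚₚ.+-identityʳ _ ⟩
      K (suc c) a m
        ∎

  K-stable : ∀ b a d → b ≤ a → K b a (a ℕ.+ d) ≡ K b a a
  K-stable b a zero    b≤a = cong (K b a) (ℕₚ.+-identityʳ a)
  K-stable b a (suc d) b≤a = begin
    K b a (a ℕ.+ suc d)  ≡⟨ cong (K b a) (ℕₚ.+-suc a d) ⟩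
    K b a (suc (a ℕ.+ d)) ≡⟨ K-suc b a (a ℕ.+ d) b≤a (ℕₚ.m≤m+n a d) ⟩
    K b a (a ℕ.+ d)      ≡⟨ K-stable b a d b≤a ⟩
    K b a a              ∎

  K-diag : ∀ b a → b ≤ a → K b a a ≡ a C b * rothe (+ 0) (a ∸ b)
  K-diag b a b≤a = begin
    ∑[ k < suc a ] (sgn k * powℕ q (tri k) * a C k * (a ∸ k) C b)
      ≡⟨ ∑-cong (suc a) (λ k _ → trans (ℚₚ.*-assoc (sgn k * powℕ q (tri k)) (a C k) _)
                                 (trans (cong (_*_ (sgn k * powℕ q (tri k))) (nCk*[n∸k]Cm≡nCm*[n∸m]Ck a k b))
                                        (swap (sgn k * powℕ q (tri k)) (a C b) ((a ∸ b) C k)))) ⟩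
    ∑[ k < suc a ] (a C b * (sgn k * powℕ q (tri k) * (a ∸ b) C k))
      ≡⟨ *-distribˡ-∑ (suc a) (a C b) _ ⟨
    a C b * ∑[ k < suc a ] (sgn k * powℕ q (tri k) * (a ∸ b) C k)
      ≡⟨ cong (_*_ (a C b)) (∑-trim _ (s≤s (ℕₚ.m∸n≤m a b)) (λ k a∸b<k _ →
           trans (cong (_*_ (sgn k * powℕ q (tri k))) (n<k⇒nCk≡0 a∸b<k)) (ℚₚ.*-zeroʳ (sgn k * powℕ q (tri k))))) ⟩
    a C b * rothe (+ 0) (a ∸ b)
      ∎
    where
    swap : ∀ t x y → t * (x * y) ≡ x * (t * y)
    swap = solve-∀ ℚ-ring

  K-closed : ∀ b u d → qPoch q b ≢ 0ℚ → powℕ q (tri b) * K b (b ℕ.+ u) (b ℕ.+ u ℕ.+ d) ≡ rothe (+ b) u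
  K-closed b u d Pb≢0 = *-cancelˡ Pb≢0 (begin
    qPoch q b * (powℕ q (tri b) * K b a (a ℕ.+ d))
      ≡⟨ cong (λ y → qPoch q b * (powℕ q (tri b) * y)) (trans (K-stable b a d b≤a) (K-diag b a b≤a)) ⟩
    qPoch q b * (powℕ q (tri b) * (a C b * rothe (+ 0) (a ∸ b)))
      ≡⟨ cong (λ n → qPoch q b * (powℕ q (tri b) * (a C b * rothe (+ 0) n))) (ℕₚ.m+n∸m≡n b u) ⟩
    qPoch q b * (powℕ q (tri b) * (a C b * rothe (+ 0) u))
      ≡⟨ cong (λ y → qPoch q b * (powℕ q (tri b) * (a C b * y))) q-binomial ⟩
    qPoch q b * (powℕ q (tri b) * (a C b * qPoch q u))
      ≡⟨ regroup (qPoch q b) (powℕ q (tri b)) (a C b) (qPoch q u) ⟩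
    powℕ q (tri b) * (a C b * (qPoch q b * qPoch q u))
      ≡⟨ cong (_*_ (powℕ q (tri b))) ([k+d]Ck*qPoch≡qPoch b u) ⟩
    powℕ q (tri b) * qPoch q a
      ≡⟨ qPoch*rothe b u ⟨
    qPoch q b * rothe (+ b) u
      ∎)
    where
    a = b ℕ.+ u
    b≤a = ℕₚ.m≤m+n b u
    q-binomial : rothe (+ 0) u ≡ qPoch q u
    q-binomial = trans (sym (ℚₚ.*-identityˡ _)) (trans (qPoch*rothe 0 u) (ℚₚ.*-identityˡ _))
    regroup : ∀ P t x Q → P * (t * (x * Q)) ≡ t * (x * (P * Q))
    regroup = solve-∀ ℚ-ring

-- Both sides in powers of z

coeff : ℕ → ℚ → ℕ → ℚ
coeff L q N = ∑[ n < suc N ] (powℕ q (triℤ (+ L ℤ.- + n)) * powℕ (- powℕ q n) (N ∸ n))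

normalForm : ℕ → ℚ → ℚ → ℚ
normalForm L q z = inv (powℕ z L) * ∑[ t < suc (2 ℕ.* L) ] (powℕ z t * coeff L q (2 ℕ.* L ∸ t))

-- The left-hand side

geometric : ℚ → ℚ → ℕ → ℚ
geometric x y K = ∑[ u < suc K ] (powℕ x u * powℕ y (K ∸ u))

geometric-sum : ∀ x y K → (x + - y) * geometric x y K ≡ powℕ x (suc K) + - powℕ y (suc K)
geometric-sum x y zero    = base x y
  where
  base : ∀ x y → (x + - y) * (0ℚ + 1ℚ * 1ℚ) ≡ x * 1ℚ + - (y * 1ℚ)
  base = solve-∀ ℚ-ring
geometric-sum x y (suc K) = begin
  (x + - y) * geometric x y (suc K)
    ≡⟨ cong (_*_ (x + - y)) (∑-sucˡ (suc K) _) ⟩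
  (x + - y) * (1ℚ * powℕ y (suc K) + ∑[ u < suc K ] (x * powℕ x u * powℕ y (K ∸ u)))
    ≡⟨ cong (λ s → (x + - y) * (1ℚ * powℕ y (suc K) + s))
            (trans (∑-cong (suc K) (λ u _ → ℚₚ.*-assoc x _ _)) (sym (*-distribˡ-∑ (suc K) x _))) ⟩
  (x + - y) * (1ℚ * powℕ y (suc K) + x * geometric x y K)
    ≡⟨ expand x y (powℕ y (suc K)) (geometric x y K) ⟩
  x * powℕ y (suc K) + - (y * powℕ y (suc K)) + x * ((x + - y) * geometric x y K)
    ≡⟨ cong (λ s → x * powℕ y (suc K) + - (y * powℕ y (suc K)) + x * s) (geometric-sum x y K) ⟩
  x * powℕ y (suc K) + - (y * powℕ y (suc K)) + x * (powℕ x (suc K) + - powℕ y (suc K))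
    ≡⟨ collect x y (powℕ x (suc K)) (powℕ y (suc K)) ⟩
  x * powℕ x (suc K) + - (y * powℕ y (suc K))
    ∎
  where
  expand : ∀ x y Y G → (x + - y) * (1ℚ * Y + x * G) ≡ x * Y + - (y * Y) + x * ((x + - y) * G)
  expand = solve-∀ ℚ-ring
  collect : ∀ x y X Y → x * Y + - (y * Y) + x * (X + - Y) ≡ x * X + - (y * Y)
  collect = solve-∀ ℚ-ring

module LeftHandSide (L : ℕ) (q z : ℚ) (z≢0 : z ≢ 0ℚ) where

  2L = 2 ℕ.* L

  lhsTerm-numerator : ∀ n → n ≤ 2L →
              sgn n * powℤ z (ℤ.- + L) * powℤ q (+ n ℤ.* (+ 2L ℤ.- + n ℤ.+ + 1)) + powℤ z (+ L ℤ.- + n ℤ.+ + 1) ≡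
              inv (powℕ z L) * (powℕ z (suc (2L ∸ n)) + - powℕ (- powℕ q n) (suc (2L ∸ n)))
  lhsTerm-numerator n n≤2L = begin
    sgn n * powℤ z (ℤ.- + L) * powℤ q (+ n ℤ.* (+ 2L ℤ.- + n ℤ.+ + 1)) + powℤ z (+ L ℤ.- + n ℤ.+ + 1)
      ≡⟨ cong₂ (λ u v → sgn n * powℤ z (ℤ.- + L) * u + v)
               (cong (powℤ q) exponent-q) (trans (cong (powℤ z) exponent-z) (powℤ-sub (suc K) L z≢0)) ⟩
    sgn n * powℤ z (ℤ.- + L) * powℕ q (n ℕ.* suc K) + iz * powℕ z (suc K)
      ≡⟨ cong₂ (λ s u → s * u * powℕ q (n ℕ.* suc K) + iz * powℕ z (suc K))
               (sgn-odd {L} {n} {suc K} n+[1+K]≡1+2L) (powℤ-neg z L) ⟩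
    - sgn (suc K) * iz * powℕ q (n ℕ.* suc K) + iz * powℕ z (suc K)
      ≡⟨ cong (λ u → - sgn (suc K) * iz * u + iz * powℕ z (suc K)) (powℕ-* q n (suc K)) ⟩
    - sgn (suc K) * iz * powℕ (powℕ q n) (suc K) + iz * powℕ z (suc K)
      ≡⟨ regroup (sgn (suc K)) iz (powℕ (powℕ q n) (suc K)) (powℕ z (suc K)) ⟩
    iz * (powℕ z (suc K) + - (sgn (suc K) * powℕ (powℕ q n) (suc K)))
      ≡⟨ cong (λ u → iz * (powℕ z (suc K) + - u)) (powℕ-neg (powℕ q n) (suc K)) ⟨
    iz * (powℕ z (suc K) + - powℕ (- powℕ q n) (suc K))
      ∎
    where
    K = 2L ∸ n
    iz = inv (powℕ z L)
    +K≡ : + K ≡ + L ℤ.+ + L ℤ.- + n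
    +K≡ = trans (+[m∸n]≡+m-+n n≤2L) (cong (ℤ._- + n) (+2L≡+L+L L))
    n+[1+K]≡1+2L : n ℕ.+ suc K ≡ suc 2L
    n+[1+K]≡1+2L = trans (ℕₚ.+-suc n K) (cong suc (ℕₚ.m+[n∸m]≡n n≤2L))
    shift : ∀ l n → l ℤ.- n ℤ.+ + 1 ≡ + 1 ℤ.+ (l ℤ.+ l ℤ.- n) ℤ.- l
    shift = ℤ-Ring.solve-∀
    exponent-z : + L ℤ.- + n ℤ.+ + 1 ≡ + suc K ℤ.- + L
    exponent-z = trans (shift (+ L) (+ n)) (cong (λ k → + 1 ℤ.+ k ℤ.- + L) (sym +K≡))
    exponent-q : + n ℤ.* (+ 2L ℤ.- + n ℤ.+ + 1) ≡ + (n ℕ.* suc K)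
    exponent-q = begin
      + n ℤ.* (+ 2L ℤ.- + n ℤ.+ + 1) ≡⟨ cong (λ k → + n ℤ.* (k ℤ.+ + 1)) (+[m∸n]≡+m-+n n≤2L) ⟨
      + n ℤ.* + (K ℕ.+ 1)            ≡⟨ ℤₚ.pos-* n (K ℕ.+ 1) ⟨
      + (n ℕ.* (K ℕ.+ 1))            ≡⟨ cong (λ k → + (n ℕ.* k)) (ℕₚ.+-comm K 1) ⟩
      + (n ℕ.* suc K)                ∎
    regroup : ∀ s i X Z → - s * i * X + i * Z ≡ i * (Z + - (s * X))
    regroup = solve-∀ ℚ-ring

  lhsTerm≡ : ∀ n → n ≤ 2L → powℕ q n + z ≢ 0ℚ →
             lhsTerm L q z n ≡ inv (powℕ z L) * (powℕ q (triℤ (+ L ℤ.- + n)) * geometric z (- powℕ q n) (2L ∸ n))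
  lhsTerm≡ n n≤2L qⁿ+z≢0 = begin
    lhsTerm L q z n
      ≡⟨ cong₂ (λ u v → u * inv (powℕ q n + z) * powℤ q v) (lhsTerm-numerator n n≤2L) (T≡triℤ (+ L ℤ.- + n)) ⟩
    iz * (powℕ z (suc K) + - powℕ y (suc K)) * inv (powℕ q n + z) * Q
      ≡⟨ cong (λ u → iz * u * inv (powℕ q n + z) * Q) (geometric-sum z y K) ⟨
    iz * ((z + - y) * geometric z y K) * inv (powℕ q n + z) * Q
      ≡⟨ collect iz z (powℕ q n) (geometric z y K) (inv (powℕ q n + z)) Q ⟩
    iz * (Q * geometric z y K) * ((powℕ q n + z) * inv (powℕ q n + z))
      ≡⟨ cong (_*_ (iz * (Q * geometric z y K))) (inv-inverseʳ qⁿ+z≢0) ⟩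
    iz * (Q * geometric z y K) * 1ℚ
      ≡⟨ ℚₚ.*-identityʳ _ ⟩
    iz * (Q * geometric z y K)
      ∎
    where
    K = 2L ∸ n
    y = - powℕ q n
    iz = inv (powℕ z L)
    Q = powℕ q (triℤ (+ L ℤ.- + n))
    collect : ∀ i z p G v Q → i * ((z + - (- p)) * G) * v * Q ≡ i * (Q * G) * ((p + z) * v)
    collect = solve-∀ ℚ-ring

  LHS≡normalForm : (∀ n → n ≤ 2L → powℕ q n + z ≢ 0ℚ) → LHS L q z ≡ normalForm L q z
  LHS≡normalForm qⁿ+z≢0 = begin
    sumTo 2L (lhsTerm L q z)
      ≡⟨ sumTo≡∑ 2L _ ⟩
    ∑[ n < suc 2L ] lhsTerm L q z n
      ≡⟨ ∑-cong (suc 2L) (λ n n≤2L → lhsTerm≡ n (ℕₚ.≤-pred n≤2L) (qⁿ+z≢0 n (ℕₚ.≤-pred n≤2L))) ⟩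
    ∑[ n < suc 2L ] (iz * (Q n * geometric z (- powℕ q n) (2L ∸ n)))
      ≡⟨ *-distribˡ-∑ (suc 2L) iz _ ⟨
    iz * ∑[ n < suc 2L ] (Q n * geometric z (- powℕ q n) (2L ∸ n))
      ≡⟨ cong (_*_ iz) (∑-cong (suc 2L) (λ n n≤2L → expand n (ℕₚ.≤-pred n≤2L))) ⟩
    iz * ∑[ n < suc 2L ] ∑[ t < suc 2L ∸ n ] g n t
      ≡⟨ cong (_*_ iz) (∑-triangle-comm (suc 2L) g) ⟩
    iz * ∑[ t < suc 2L ] ∑[ n < suc 2L ∸ t ] g n t
      ≡⟨ cong (_*_ iz) (∑-cong (suc 2L) (λ t t≤2L → collect t (ℕₚ.≤-pred t≤2L))) ⟩
    iz * ∑[ t < suc 2L ] (powℕ z t * coeff L q (2L ∸ t))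
      ∎
    where
    iz = inv (powℕ z L)
    Q : ℕ → ℚ
    Q n = powℕ q (triℤ (+ L ℤ.- + n))
    g : ℕ → ℕ → ℚ
    g n t = powℕ z t * (Q n * powℕ (- powℕ q n) ((2L ∸ n) ∸ t))
    swap : ∀ Q x y → Q * (x * y) ≡ x * (Q * y)
    swap = solve-∀ ℚ-ring
    expand : ∀ n → n ≤ 2L → Q n * geometric z (- powℕ q n) (2L ∸ n) ≡ ∑[ t < suc 2L ∸ n ] g n t
    expand n n≤2L = begin
      Q n * geometric z (- powℕ q n) (2L ∸ n)  ≡⟨ *-distribˡ-∑ (suc (2L ∸ n)) (Q n) _ ⟩
      ∑[ t < suc (2L ∸ n) ] (Q n * (powℕ z t * powℕ (- powℕ q n) ((2L ∸ n) ∸ t)))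
                                               ≡⟨ ∑-cong (suc (2L ∸ n)) (λ t _ → swap (Q n) (powℕ z t) _) ⟩
      ∑[ t < suc (2L ∸ n) ] g n t              ≡⟨ cong (λ k → ∑ k (g n)) (ℕₚ.+-∸-assoc 1 n≤2L) ⟨
      ∑[ t < suc 2L ∸ n ] g n t                ∎
    collect : ∀ t → t ≤ 2L → ∑[ n < suc 2L ∸ t ] g n t ≡ powℕ z t * coeff L q (2L ∸ t)
    collect t t≤2L = begin
      ∑[ n < suc 2L ∸ t ] g n t
        ≡⟨ cong (λ k → ∑[ n < k ] g n t) (ℕₚ.+-∸-assoc 1 t≤2L) ⟩
      ∑[ n < suc (2L ∸ t) ] g n t              ≡⟨ ∑-cong (suc (2L ∸ t)) (λ n _ →
                                                    cong (λ e → powℕ z t * (Q n * powℕ (- powℕ q n) e)) (∸-comm 2L n t)) ⟩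
      ∑[ n < suc (2L ∸ t) ] (powℕ z t * (Q n * powℕ (- powℕ q n) ((2L ∸ t) ∸ n)))
                                               ≡⟨ *-distribˡ-∑ (suc (2L ∸ t)) (powℕ z t) _ ⟨
      powℕ z t * coeff L q (2L ∸ t)
        ∎

-- The right-hand side

module RightHandSide (L : ℕ) (q z : ℚ) (z≢0 : z ≢ 0ℚ) (qPoch≢0 : ∀ m → m ≤ L → qPoch q m ≢ 0ℚ) where

  open Gaussian q

  2L = 2 ℕ.* L
  iz = inv (powℕ z L)

  summand : ℕ → ℤ → ℕ → ℚ
  summand a x j = powℕ q (choose2 j) * a C j * rothe x (a ∸ j)

  -- The contribution of j to the coefficient of z^(t - L).
  W : ℕ → ℕ → ℚ
  W t j = summand ((2L ∸ t) ∸ j) (+ (j ℕ.+ t) ℤ.- + L) j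

  W-vanish : ∀ t j → (2L ∸ t) ∸ j < j → W t j ≡ 0ℚ
  W-vanish t j a<j = trans (cong (λ y → powℕ q (choose2 j) * y * rothe (+ (j ℕ.+ t) ℤ.- + L) ((2L ∸ t) ∸ j ∸ j))
                                 (n<k⇒nCk≡0 a<j))
                           (zero-middle (powℕ q (choose2 j)) _)
    where
    zero-middle : ∀ x y → x * 0ℚ * y ≡ 0ℚ
    zero-middle = solve-∀ ℚ-ring

  W-low : ∀ t d j → L ≡ t ℕ.+ suc d ℕ.+ j → W t j ≡ 0ℚ
  W-low t d j L≡ = begin
    powℕ q (choose2 j) * ((2L ∸ t) ∸ j) C j * rothe (+ (j ℕ.+ t) ℤ.- + L) ((2L ∸ t) ∸ j ∸ j)
      ≡⟨ cong (_*_ (powℕ q (choose2 j) * ((2L ∸ t) ∸ j) C j)) (rothe≡0 L≡) ⟩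
    powℕ q (choose2 j) * ((2L ∸ t) ∸ j) C j * 0ℚ
      ≡⟨ ℚₚ.*-zeroʳ (powℕ q (choose2 j) * ((2L ∸ t) ∸ j) C j) ⟩
    0ℚ ∎
    where
    double : ∀ t d j → 2 ℕ.* (t ℕ.+ suc d ℕ.+ j) ≡ t ℕ.+ (j ℕ.+ (j ℕ.+ (suc d ℕ.+ (t ℕ.+ suc d))))
    double = ℕ-Ring.solve-∀
    negative : ∀ t d j → (j ℤ.+ t) ℤ.- (t ℤ.+ (+ 1 ℤ.+ d) ℤ.+ j) ≡ ℤ.- (+ 1 ℤ.+ d)
    negative = ℤ-Ring.solve-∀
    rothe≡0 : ∀ {l} → l ≡ t ℕ.+ suc d ℕ.+ j →
              rothe (+ (j ℕ.+ t) ℤ.- + l) ((2 ℕ.* l ∸ t) ∸ j ∸ j) ≡ 0ℚ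
    rothe≡0 refl = begin
      rothe (+ (j ℕ.+ t) ℤ.- + (t ℕ.+ suc d ℕ.+ j)) ((2 ℕ.* (t ℕ.+ suc d ℕ.+ j) ∸ t) ∸ j ∸ j)
        ≡⟨ cong₂ rothe (negative (+ t) (+ d) (+ j)) (trans (cong (λ n → (n ∸ t) ∸ j ∸ j) (double t d j))
             (trans (cong (λ n → n ∸ j ∸ j) (ℕₚ.m+n∸m≡n t _))
               (trans (cong (_∸ j) (ℕₚ.m+n∸m≡n j _)) (ℕₚ.m+n∸m≡n j _)))) ⟩
      rothe -[1+ d ] (suc d ℕ.+ (t ℕ.+ suc d))
        ≡⟨ rothe-neg d _ (s≤s (ℕₚ.m≤m+n d _)) ⟩
      0ℚ ∎

  qBin[L-b]≡C : ∀ b a → b ≤ L → qBin q (+ L ℤ.- + b) (+ a) ≡ (L ∸ b) C a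
  qBin[L-b]≡C b a b≤L = trans (cong (λ n → qBin q n (+ a)) (sym (+[m∸n]≡+m-+n b≤L)))
                          (qBin≡C (L ∸ b) a (λ m m≤L∸b → qPoch≢0 m (ℕₚ.≤-trans m≤L∸b (ℕₚ.m∸n≤m L b))))

  rhsTerm≡ : ∀ i j k → i ≤ L → j ≤ L → k ≤ L →
             rhsTerm L q z i j k ≡
             iz * powℕ z (i ℕ.+ (L ∸ j)) * (powℕ q (tri i ℕ.+ choose2 j) * (L ∸ i) C j)
               * (sgn k * powℕ q (tri k) * (L ∸ j) C k * (L ∸ k) C i)
  rhsTerm≡ i j k i≤L j≤L k≤L = begin
    rhsTerm L q z i j k
      ≡⟨ cong₂ (λ x y → sgn k * x * y * qBin q (+ L ℤ.- + i) (+ j) * qBin q (+ L ℤ.- + j) (+ k) * qBin q (+ L ℤ.- + k) (+ i))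
               (trans (cong (powℤ z) exponent-z) (powℤ-sub (i ℕ.+ (L ∸ j)) L z≢0))
               (trans (cong (powℤ q) (T+T+T-j≡ i j k)) (powℕ-+ q (tri i ℕ.+ choose2 j) (tri k))) ⟩
    sgn k * (iz * Z) * (Q * powℕ q (tri k))
      * qBin q (+ L ℤ.- + i) (+ j) * qBin q (+ L ℤ.- + j) (+ k) * qBin q (+ L ℤ.- + k) (+ i)
      ≡⟨ cong₂ (λ x y → sgn k * (iz * Z) * (Q * powℕ q (tri k)) * x * y * qBin q (+ L ℤ.- + k) (+ i))
               (qBin[L-b]≡C i j i≤L) (qBin[L-b]≡C j k j≤L) ⟩
    sgn k * (iz * Z) * (Q * powℕ q (tri k)) * (L ∸ i) C j * (L ∸ j) C k * qBin q (+ L ℤ.- + k) (+ i)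
      ≡⟨ cong (_*_ (sgn k * (iz * Z) * (Q * powℕ q (tri k)) * (L ∸ i) C j * (L ∸ j) C k)) (qBin[L-b]≡C k i k≤L) ⟩
    sgn k * (iz * Z) * (Q * powℕ q (tri k)) * (L ∸ i) C j * (L ∸ j) C k * (L ∸ k) C i
      ≡⟨ regroup (sgn k) iz Z Q (powℕ q (tri k)) ((L ∸ i) C j) ((L ∸ j) C k) ((L ∸ k) C i) ⟩
    iz * Z * (Q * (L ∸ i) C j) * (sgn k * powℕ q (tri k) * (L ∸ j) C k * (L ∸ k) C i)
      ∎
    where
    Z = powℕ z (i ℕ.+ (L ∸ j))
    Q = powℕ q (tri i ℕ.+ choose2 j)
    regroup : ∀ s i Z Q P x y w → s * (i * Z) * (Q * P) * x * y * w ≡ i * Z * (Q * x) * (s * P * y * w)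
    regroup = solve-∀ ℚ-ring
    shift : ∀ i j l → i ℤ.- j ≡ i ℤ.+ (l ℤ.- j) ℤ.- l
    shift = ℤ-Ring.solve-∀
    exponent-z : + i ℤ.- + j ≡ + (i ℕ.+ (L ∸ j)) ℤ.- + L
    exponent-z = trans (shift (+ i) (+ j) (+ L)) (cong (λ x → + i ℤ.+ x ℤ.- + L) (sym (+[m∸n]≡+m-+n j≤L)))

  K-summand : ∀ i j → i ≤ L → j ≤ L →
              powℕ q (tri i ℕ.+ choose2 j) * (L ∸ i) C j * K i (L ∸ j) L ≡ summand (L ∸ i) (+ i) j
  K-summand i j i≤L j≤L with j ℕₚ.≤? L ∸ i
  ... | yes j≤L∸i = begin
    powℕ q (tri i ℕ.+ choose2 j) * (L ∸ i) C j * K i (L ∸ j) L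
      ≡⟨ cong (λ y → y * (L ∸ i) C j * K i (L ∸ j) L) (powℕ-+ q (tri i) (choose2 j)) ⟩
    powℕ q (tri i) * powℕ q (choose2 j) * (L ∸ i) C j * K i (L ∸ j) L
      ≡⟨ regroup (powℕ q (tri i)) (powℕ q (choose2 j)) ((L ∸ i) C j) (K i (L ∸ j) L) ⟩
    powℕ q (choose2 j) * (L ∸ i) C j * (powℕ q (tri i) * K i (L ∸ j) L)
      ≡⟨ cong (_*_ (powℕ q (choose2 j) * (L ∸ i) C j)) closed ⟩
    powℕ q (choose2 j) * (L ∸ i) C j * rothe (+ i) u
      ∎
    where
    u = (L ∸ i) ∸ j
    regroup : ∀ t c x k → t * c * x * k ≡ c * x * (t * k)
    regroup = solve-∀ ℚ-ring
    L∸j≡i+u : L ∸ j ≡ i ℕ.+ u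
    L∸j≡i+u = trans (cong (_∸ j) (sym (ℕₚ.m+[n∸m]≡n i≤L))) (ℕₚ.+-∸-assoc i j≤L∸i)
    L≡i+u+j : L ≡ i ℕ.+ u ℕ.+ j
    L≡i+u+j = trans (sym (ℕₚ.m∸n+n≡m j≤L)) (cong (ℕ._+ j) L∸j≡i+u)
    closed : powℕ q (tri i) * K i (L ∸ j) L ≡ rothe (+ i) u
    closed = trans (cong₂ (λ a m → powℕ q (tri i) * K i a m) L∸j≡i+u L≡i+u+j) (K-closed i u j (qPoch≢0 i i≤L))
  ... | no  j≰L∸i = begin
    powℕ q (tri i ℕ.+ choose2 j) * (L ∸ i) C j * K i (L ∸ j) L
      ≡⟨ cong (λ y → powℕ q (tri i ℕ.+ choose2 j) * y * K i (L ∸ j) L) [L∸i]Cj≡0 ⟩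
    powℕ q (tri i ℕ.+ choose2 j) * 0ℚ * K i (L ∸ j) L
      ≡⟨ zeros (powℕ q (tri i ℕ.+ choose2 j)) (K i (L ∸ j) L) (powℕ q (choose2 j)) (rothe (+ i) ((L ∸ i) ∸ j)) ⟩
    powℕ q (choose2 j) * 0ℚ * rothe (+ i) ((L ∸ i) ∸ j)
      ≡⟨ cong (λ y → powℕ q (choose2 j) * y * rothe (+ i) ((L ∸ i) ∸ j)) [L∸i]Cj≡0 ⟨
    summand (L ∸ i) (+ i) j
      ∎
    where
    [L∸i]Cj≡0 = n<k⇒nCk≡0 (ℕₚ.≰⇒> j≰L∸i)
    zeros : ∀ a b c d → a * 0ℚ * b ≡ c * 0ℚ * d
    zeros = solve-∀ ℚ-ring

  summand≡W : ∀ i j → j ≤ L → summand (L ∸ i) (+ i) j ≡ W (i ℕ.+ (L ∸ j)) j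
  summand≡W i j j≤L = cong₂ (λ a x → summand a x j) (sym (trans (ℕₚ.∸-+-assoc 2L t j) 2L∸[t+j]≡L∸i)) (sym x≡i)
    where
    t = i ℕ.+ (L ∸ j)
    t+j≡i+L : t ℕ.+ j ≡ i ℕ.+ L
    t+j≡i+L = trans (ℕₚ.+-assoc i (L ∸ j) j) (cong (i ℕ.+_) (ℕₚ.m∸n+n≡m j≤L))
    2L∸[t+j]≡L∸i : 2L ∸ (t ℕ.+ j) ≡ L ∸ i
    2L∸[t+j]≡L∸i = trans (cong₂ _∸_ (cong (L ℕ.+_) (ℕₚ.+-identityʳ L)) (trans t+j≡i+L (ℕₚ.+-comm i L)))
                         (ℕₚ.[m+n]∸[m+o]≡n∸o L L i)
    cancel : ∀ i l → i ℤ.+ l ℤ.- l ≡ i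
    cancel = ℤ-Ring.solve-∀
    x≡i : + (j ℕ.+ t) ℤ.- + L ≡ + i
    x≡i = trans (cong (λ n → + n ℤ.- + L) (trans (ℕₚ.+-comm j t) t+j≡i+L)) (cancel (+ i) (+ L))

  ∑-rhsTerm : ∀ i j → i ≤ L → j ≤ L →
              ∑[ k < suc L ] rhsTerm L q z i j k ≡ iz * powℕ z (i ℕ.+ (L ∸ j)) * W (i ℕ.+ (L ∸ j)) j
  ∑-rhsTerm i j i≤L j≤L = begin
    ∑[ k < suc L ] rhsTerm L q z i j k
      ≡⟨ ∑-cong (suc L) (λ k k≤L → rhsTerm≡ i j k i≤L j≤L (ℕₚ.≤-pred k≤L)) ⟩
    ∑[ k < suc L ] (c * (sgn k * powℕ q (tri k) * (L ∸ j) C k * (L ∸ k) C i))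
      ≡⟨ *-distribˡ-∑ (suc L) c _ ⟨
    c * K i (L ∸ j) L
      ≡⟨ ℚₚ.*-assoc (iz * powℕ z (i ℕ.+ (L ∸ j))) _ _ ⟩
    iz * powℕ z (i ℕ.+ (L ∸ j)) * (powℕ q (tri i ℕ.+ choose2 j) * (L ∸ i) C j * K i (L ∸ j) L)
      ≡⟨ cong (_*_ (iz * powℕ z (i ℕ.+ (L ∸ j)))) (trans (K-summand i j i≤L j≤L) (summand≡W i j j≤L)) ⟩
    iz * powℕ z (i ℕ.+ (L ∸ j)) * W (i ℕ.+ (L ∸ j)) j
      ∎
    where
    c = iz * powℕ z (i ℕ.+ (L ∸ j)) * (powℕ q (tri i ℕ.+ choose2 j) * (L ∸ i) C j)

  ∑-reindex : ∀ j → j ≤ L →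
              ∑[ i < suc L ] (iz * powℕ z (i ℕ.+ (L ∸ j)) * W (i ℕ.+ (L ∸ j)) j) ≡
              ∑[ t < suc 2L ] (iz * powℕ z t * W t j)
  ∑-reindex j j≤L = sym (begin
    ∑[ t < suc 2L ] h t
      ≡⟨ cong (λ n → ∑ n h) (subst (λ l → suc (2 ℕ.* l) ≡ a ℕ.+ suc l ℕ.+ j) L≡a+j (bound a j)) ⟩
    ∑ (a ℕ.+ suc L ℕ.+ j) h
      ≡⟨ ∑-window a (suc L) j h low high ⟩
    ∑[ i < suc L ] h (a ℕ.+ i)
      ≡⟨ ∑-cong (suc L) (λ i _ → cong h (ℕₚ.+-comm a i)) ⟩
    ∑[ i < suc L ] h (i ℕ.+ a)
      ∎)
    where
    a = L ∸ j
    L≡a+j : a ℕ.+ j ≡ L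
    L≡a+j = ℕₚ.m∸n+n≡m j≤L
    h : ℕ → ℚ
    h t = iz * powℕ z t * W t j
    bound : ∀ a j → suc (2 ℕ.* (a ℕ.+ j)) ≡ a ℕ.+ suc (a ℕ.+ j) ℕ.+ j
    bound = ℕ-Ring.solve-∀
    top : ∀ a j u → 2 ℕ.* (a ℕ.+ j) ℕ.+ suc u ≡ a ℕ.+ suc (a ℕ.+ j) ℕ.+ u ℕ.+ j
    top = ℕ-Ring.solve-∀
    low : ∀ t → t < a → h t ≡ 0ℚ
    low t t<a = trans (cong (_*_ (iz * powℕ z t)) (W-low t (a ∸ suc t) j L≡)) (ℚₚ.*-zeroʳ (iz * powℕ z t))
      where
      L≡ : L ≡ t ℕ.+ suc (a ∸ suc t) ℕ.+ j
      L≡ = trans (sym L≡a+j) (cong (ℕ._+ j) (trans (sym (ℕₚ.m+[n∸m]≡n t<a)) (sym (ℕₚ.+-suc t (a ∸ suc t)))))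
    high : ∀ u → u < j → h (a ℕ.+ suc L ℕ.+ u) ≡ 0ℚ
    high u u<j = trans (cong (_*_ (iz * powℕ z t)) (W-vanish t j (subst (_< j) (sym N∸j≡0) (ℕₚ.≤-<-trans z≤n u<j))))
                       (ℚₚ.*-zeroʳ (iz * powℕ z t))
      where
      t = a ℕ.+ suc L ℕ.+ u
      2L≤t+j : 2L ≤ t ℕ.+ j
      2L≤t+j = subst (λ l → 2 ℕ.* l ≤ a ℕ.+ suc l ℕ.+ u ℕ.+ j) L≡a+j
                     (subst (2 ℕ.* (a ℕ.+ j) ≤_) (top a j u) (ℕₚ.m≤m+n _ (suc u)))
      N∸j≡0 : (2L ∸ t) ∸ j ≡ 0
      N∸j≡0 = trans (ℕₚ.∸-+-assoc 2L t j) (ℕₚ.m≤n⇒m∸n≡0 2L≤t+j)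

  F : ℕ → ℕ → ℕ → ℚ
  F t j r = sgn r * powℕ q (choose2 j) * powℕ q (triℤ (+ (j ℕ.+ t) ℤ.- + L ℤ.+ + r))
            * ((2L ∸ t ∸ j) C j * (2L ∸ t ∸ j ∸ j) C r)

  W≡∑F : ∀ t j → j ≤ 2L ∸ t → W t j ≡ ∑[ r < suc (2L ∸ t) ∸ j ] F t j r
  W≡∑F t j j≤N = begin
    powℕ q (choose2 j) * a C j * rothe x (a ∸ j)
      ≡⟨ *-distribˡ-∑ (suc (a ∸ j)) (powℕ q (choose2 j) * a C j) _ ⟩
    ∑[ r < suc (a ∸ j) ] (powℕ q (choose2 j) * a C j * (sgn r * powℕ q (triℤ (x ℤ.+ + r)) * (a ∸ j) C r))
      ≡⟨ ∑-cong (suc (a ∸ j)) (λ r _ → regroup (powℕ q (choose2 j)) (a C j) (sgn r) _ ((a ∸ j) C r)) ⟩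
    ∑[ r < suc (a ∸ j) ] F t j r
      ≡⟨ ∑-trim (F t j) (s≤s (ℕₚ.m∸n≤m a j)) vanish ⟨
    ∑[ r < suc a ] F t j r
      ≡⟨ cong (λ n → ∑ n (F t j)) (ℕₚ.+-∸-assoc 1 j≤N) ⟨
    ∑[ r < suc (2L ∸ t) ∸ j ] F t j r
      ∎
    where
    a = 2L ∸ t ∸ j
    x = + (j ℕ.+ t) ℤ.- + L
    regroup : ∀ c b s e b′ → c * b * (s * e * b′) ≡ s * c * e * (b * b′)
    regroup = solve-∀ ℚ-ring
    vanish : ∀ r → suc (a ∸ j) ≤ r → r < suc a → F t j r ≡ 0ℚ
    vanish r a∸j<r _ = trans (cong (λ y → sgn r * powℕ q (choose2 j) * powℕ q (triℤ (x ℤ.+ + r)) * (a C j * y))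
                                   (n<k⇒nCk≡0 a∸j<r))
                             (zeros (sgn r * powℕ q (choose2 j) * powℕ q (triℤ (x ℤ.+ + r))) (a C j))
      where
      zeros : ∀ c b → c * (b * 0ℚ) ≡ 0ℚ
      zeros = solve-∀ ℚ-ring

  F-antidiagonal : ∀ t j p → j ≤ p →
                   F t j (p ∸ j) ≡ sgn p * powℕ q (triℤ (+ (t ℕ.+ p) ℤ.- + L))
                                     * (sgn j * powℕ q (choose2 j) * (2L ∸ t ∸ j) C p * p C j)
  F-antidiagonal t j p j≤p = begin
    sgn (p ∸ j) * powℕ q (choose2 j) * powℕ q (triℤ (x ℤ.+ + (p ∸ j))) * (a C j * (a ∸ j) C (p ∸ j))
      ≡⟨ cong₂ (λ s e → s * powℕ q (choose2 j) * powℕ q (triℤ e) * (a C j * (a ∸ j) C (p ∸ j)))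
               (sgn-∸ j≤p) exponent ⟩
    sgn j * sgn p * powℕ q (choose2 j) * powℕ q (triℤ (+ (t ℕ.+ p) ℤ.- + L)) * (a C j * (a ∸ j) C (p ∸ j))
      ≡⟨ cong (_*_ (sgn j * sgn p * powℕ q (choose2 j) * powℕ q (triℤ (+ (t ℕ.+ p) ℤ.- + L))))
              (trans (nCk*[n∸k]Cm≡nC[k+m]*[k+m]Ck a j (p ∸ j)) (cong (λ m → a C m * m C j) (ℕₚ.m+[n∸m]≡n j≤p))) ⟩
    sgn j * sgn p * powℕ q (choose2 j) * powℕ q (triℤ (+ (t ℕ.+ p) ℤ.- + L)) * (a C p * p C j)
      ≡⟨ regroup (sgn j) (sgn p) (powℕ q (choose2 j)) _ (a C p) (p C j) ⟩
    sgn p * powℕ q (triℤ (+ (t ℕ.+ p) ℤ.- + L)) * (sgn j * powℕ q (choose2 j) * a C p * p C j)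
      ∎
    where
    a = 2L ∸ t ∸ j
    x = + (j ℕ.+ t) ℤ.- + L
    regroup : ∀ sj sp c e b b′ → sj * sp * c * e * (b * b′) ≡ sp * e * (sj * c * b * b′)
    regroup = solve-∀ ℚ-ring
    shift : ∀ j t l p → j ℤ.+ t ℤ.- l ℤ.+ (p ℤ.- j) ≡ t ℤ.+ p ℤ.- l
    shift = ℤ-Ring.solve-∀
    exponent : x ℤ.+ + (p ∸ j) ≡ + (t ℕ.+ p) ℤ.- + L
    exponent = trans (cong (ℤ._+_ x) (+[m∸n]≡+m-+n j≤p)) (shift (+ j) (+ t) (+ L) (+ p))

  ∑W-trim : ∀ t → ∑[ j < suc L ] W t j ≡ ∑[ j < suc (2L ∸ t) ] W t j
  ∑W-trim t = begin
    ∑[ j < suc L ] W t j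
      ≡⟨ ∑-trim (W t) (s≤s (ℕₚ.m≤m+n L (L ℕ.+ 0))) (λ j L<j _ → vanish j (ℕₚ.≤-<-trans (ℕₚ.m∸n≤m 2L t)
           (subst (_< j ℕ.+ j) (cong (L ℕ.+_) (sym (ℕₚ.+-identityʳ L))) (ℕₚ.+-mono-< L<j L<j)))) ⟨
    ∑[ j < suc 2L ] W t j
      ≡⟨ ∑-trim (W t) (s≤s (ℕₚ.m∸n≤m 2L t)) (λ j N<j _ → vanish j (ℕₚ.<-≤-trans N<j (ℕₚ.m≤m+n j j))) ⟩
    ∑[ j < suc (2L ∸ t) ] W t j
      ∎
    where
    vanish : ∀ j → 2L ∸ t < j ℕ.+ j → W t j ≡ 0ℚ
    vanish j N<j+j = W-vanish t j (m<n+n⇒m∸n<n N<j+j)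

  ∑F-antidiagonal : ∀ t p → p ≤ 2L ∸ t →
                    ∑[ j < suc p ] F t j (p ∸ j) ≡
                    sgn p * powℕ q (triℤ (+ (t ℕ.+ p) ℤ.- + L)) * powℕ q (p ℕ.* (2L ∸ t ∸ p))
  ∑F-antidiagonal t p p≤N = begin
    ∑[ j < suc p ] F t j (p ∸ j)
      ≡⟨ ∑-cong (suc p) (λ j j≤p → F-antidiagonal t j p (ℕₚ.≤-pred j≤p)) ⟩
    ∑[ j < suc p ] (c * (sgn j * powℕ q (choose2 j) * (N ∸ j) C p * p C j))
      ≡⟨ *-distribˡ-∑ (suc p) c _ ⟨
    c * qΔ p N p
      ≡⟨ cong (_*_ c) (cong₂ (qΔ p) (sym (ℕₚ.m+[n∸m]≡n p≤N)) (sym (ℕₚ.+-identityʳ p))) ⟩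
    c * qΔ p (p ℕ.+ (N ∸ p)) (p ℕ.+ 0)
      ≡⟨ cong (_*_ c) (qΔ-diag p (N ∸ p) 0) ⟩
    c * (powℕ q (p ℕ.* (N ∸ p)) * (N ∸ p) C 0)
      ≡⟨ cong (λ y → c * (powℕ q (p ℕ.* (N ∸ p)) * y)) (nC0≡1 (N ∸ p)) ⟩
    c * (powℕ q (p ℕ.* (N ∸ p)) * 1ℚ)
      ≡⟨ cong (_*_ c) (ℚₚ.*-identityʳ _) ⟩
    c * powℕ q (p ℕ.* (N ∸ p))
      ∎
    where
    N = 2L ∸ t
    c = sgn p * powℕ q (triℤ (+ (t ℕ.+ p) ℤ.- + L))

  coeff-term-reverse : ∀ t p → t ≤ 2L → p ≤ 2L ∸ t →
                       powℕ q (triℤ (+ L ℤ.- + (2L ∸ t ∸ p)))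
                         * powℕ (- powℕ q (2L ∸ t ∸ p)) (2L ∸ t ∸ (2L ∸ t ∸ p)) ≡
                       sgn p * powℕ q (triℤ (+ (t ℕ.+ p) ℤ.- + L)) * powℕ q (p ℕ.* (2L ∸ t ∸ p))
  coeff-term-reverse t p t≤2L p≤N = begin
    powℕ q (triℤ (+ L ℤ.- + (N ∸ p))) * powℕ (- powℕ q (N ∸ p)) (N ∸ (N ∸ p))
      ≡⟨ cong₂ (λ e k → powℕ q (triℤ e) * powℕ (- powℕ q (N ∸ p)) k) exponent (ℕₚ.m∸[m∸n]≡n p≤N) ⟩
    Q * powℕ (- powℕ q (N ∸ p)) p
      ≡⟨ cong (_*_ Q) (powℕ-neg (powℕ q (N ∸ p)) p) ⟩
    Q * (sgn p * powℕ (powℕ q (N ∸ p)) p)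
      ≡⟨ cong (λ y → Q * (sgn p * y)) (trans (sym (powℕ-* q (N ∸ p) p)) (cong (powℕ q) (ℕₚ.*-comm (N ∸ p) p))) ⟩
    Q * (sgn p * powℕ q (p ℕ.* (N ∸ p)))
      ≡⟨ swap Q (sgn p) _ ⟩
    sgn p * Q * powℕ q (p ℕ.* (N ∸ p))
      ∎
    where
    N = 2L ∸ t
    Q = powℕ q (triℤ (+ (t ℕ.+ p) ℤ.- + L))
    swap : ∀ e s x → e * (s * x) ≡ s * e * x
    swap = solve-∀ ℚ-ring
    shift : ∀ l t p → l ℤ.- (l ℤ.+ l ℤ.- t ℤ.- p) ≡ t ℤ.+ p ℤ.- l
    shift = ℤ-Ring.solve-∀
    exponent : + L ℤ.- + (N ∸ p) ≡ + (t ℕ.+ p) ℤ.- + L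
    exponent = begin
      + L ℤ.- + (N ∸ p)
        ≡⟨ cong (λ n → + L ℤ.- n) (+[m∸n]≡+m-+n p≤N) ⟩
      + L ℤ.- (+ N ℤ.- + p)
        ≡⟨ cong (λ n → + L ℤ.- (n ℤ.- + p)) (trans (+[m∸n]≡+m-+n t≤2L) (cong (ℤ._- + t) (+2L≡+L+L L))) ⟩
      + L ℤ.- (+ L ℤ.+ + L ℤ.- + t ℤ.- + p)
        ≡⟨ shift (+ L) (+ t) (+ p) ⟩
      + (t ℕ.+ p) ℤ.- + L
        ∎

  ∑W≡coeff : ∀ t → t ≤ 2L → ∑[ j < suc L ] W t j ≡ coeff L q (2L ∸ t)
  ∑W≡coeff t t≤2L = begin
    ∑[ j < suc L ] W t j
      ≡⟨ ∑W-trim t ⟩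
    ∑[ j < suc N ] W t j
      ≡⟨ ∑-cong (suc N) (λ j j≤N → W≡∑F t j (ℕₚ.≤-pred j≤N)) ⟩
    ∑[ j < suc N ] ∑[ r < suc N ∸ j ] F t j r
      ≡⟨ ∑-antidiagonal (suc N) (F t) ⟩
    ∑[ p < suc N ] ∑[ j < suc p ] F t j (p ∸ j)
      ≡⟨ ∑-cong (suc N) (λ p p≤N → ∑F-antidiagonal t p (ℕₚ.≤-pred p≤N)) ⟩
    ∑[ p < suc N ] (sgn p * powℕ q (triℤ (+ (t ℕ.+ p) ℤ.- + L)) * powℕ q (p ℕ.* (N ∸ p)))
      ≡⟨ ∑-cong (suc N) (λ p p≤N → coeff-term-reverse t p t≤2L (ℕₚ.≤-pred p≤N)) ⟨
    ∑[ p < suc N ] (powℕ q (triℤ (+ L ℤ.- + (N ∸ p))) * powℕ (- powℕ q (N ∸ p)) (N ∸ (N ∸ p)))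
      ≡⟨ ∑-reverse (suc N) _ ⟨
    coeff L q N
      ∎
    where N = 2L ∸ t

  RHS≡normalForm : RHS L q z ≡ normalForm L q z
  RHS≡normalForm = begin
    sumTo L (λ i → sumTo L (λ j → sumTo L (λ k → rhsTerm L q z i j k)))
      ≡⟨ trans (sumTo≡∑ L _)
               (∑-cong (suc L) (λ i _ → trans (sumTo≡∑ L _) (∑-cong (suc L) (λ j _ → sumTo≡∑ L _)))) ⟩
    ∑[ i < suc L ] ∑[ j < suc L ] ∑[ k < suc L ] rhsTerm L q z i j k
      ≡⟨ ∑-cong (suc L) (λ i i≤L → ∑-cong (suc L) (λ j j≤L →
           ∑-rhsTerm i j (ℕₚ.≤-pred i≤L) (ℕₚ.≤-pred j≤L))) ⟩
    ∑[ i < suc L ] ∑[ j < suc L ] (iz * powℕ z (i ℕ.+ (L ∸ j)) * W (i ℕ.+ (L ∸ j)) j)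
      ≡⟨ ∑-comm (suc L) (suc L) _ ⟩
    ∑[ j < suc L ] ∑[ i < suc L ] (iz * powℕ z (i ℕ.+ (L ∸ j)) * W (i ℕ.+ (L ∸ j)) j)
      ≡⟨ ∑-cong (suc L) (λ j j≤L → ∑-reindex j (ℕₚ.≤-pred j≤L)) ⟩
    ∑[ j < suc L ] ∑[ t < suc 2L ] (iz * powℕ z t * W t j)
      ≡⟨ ∑-comm (suc L) (suc 2L) _ ⟩
    ∑[ t < suc 2L ] ∑[ j < suc L ] (iz * powℕ z t * W t j)
      ≡⟨ ∑-cong (suc 2L) (λ t t≤2L → trans (sym (*-distribˡ-∑ (suc L) (iz * powℕ z t) (W t)))
                                          (cong (_*_ (iz * powℕ z t)) (∑W≡coeff t (ℕₚ.≤-pred t≤2L)))) ⟩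
    ∑[ t < suc 2L ] (iz * powℕ z t * coeff L q (2L ∸ t))
      ≡⟨ ∑-cong (suc 2L) (λ t _ → ℚₚ.*-assoc iz (powℕ z t) _) ⟩
    ∑[ t < suc 2L ] (iz * (powℕ z t * coeff L q (2L ∸ t)))
      ≡⟨ *-distribˡ-∑ (suc 2L) iz _ ⟨
    normalForm L q z
      ∎

mainTheorem3 : (L : ℕ) (q z : ℚ)
    → z ≢ 0ℚ
    → (∀ n → n ≤ 2 Data.Nat.* L → powℕ q n + z ≢ 0ℚ)
    → (∀ k → 1 ≤ k → k ≤ L → powℕ q k ≢ 1ℚ)
    → LHS L q z ≡ RHS L q z
mainTheorem3 L q z z≢0 qⁿ+z≢0 qᵏ≢1 = begin
  LHS L q z        ≡⟨ LeftHandSide.LHS≡normalForm L q z z≢0 qⁿ+z≢0 ⟩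
  normalForm L q z ≡⟨ RightHandSide.RHS≡normalForm L q z z≢0 (qPoch≢0 qᵏ≢1) ⟨
  RHS L q z        ∎
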